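{- Let $\mathcal{M}=\{m_I\mid I\in\Sigma\}$ be a monotone monomial family in $S=\mathbb{K}[x_1,\dots,x_n]$. Then the homological order complex $C_*(\mathcal{M})$ (for the poset $\Sigma$ ordered by inclusion) is a free resolution of the ideal $\mathcal{I}=\langle\mathcal{M}\rangle$. If $\mathcal{M}$ is strictly monotone, then $C_*(\mathcal{M})$ is a minimal free resolution of $\mathcal{I}$.
   Context: $\mathbb{K}$ is a field. A monotone monomial family is $\{m_I\mid I\in\Sigma\}$, $\Sigma$ a set of nonempty subsets of $\{1,\dots,n\}$, with $m_I=\prod_{i\in I}x_i^{\nu_I(i)}$ and: (MM1) $m_I$ involves only $x_i$, $i\in I$; (MM2) if $I\subset J$ in $\Sigma$ and $i\in I$ then $\nu_I(i)\ge\nu_J(i)$; (MM3) for $I,J\in\Sigma$ there is $K\in\Sigma$, $K\supseteq I\cup J$, with $m_K\mid\mathrm{lcm}(m_I,m_J)$. It is strictly monotone if moreover (SM1) no $m_I$ divides $m_J$ for $I\neq J$ in $\Sigma$, and (SM2) for any $I\subsetneq J\subsetneq K$ in $\Sigma$ there exists $i\in J\setminus I$ with $\nu_J(i)>\nu_K(i)$. For $U\subseteq\Sigma$, $m_U=\mathrm{lcm}(m_I\mid I\in U)$, $m_\emptyset=1$, $a_U$ its exponent vector, $S(-a)=x^aS$. The homological order complex is $\cdots\to C_2\to C_1\to C_0=S\to S/\mathcal{I}\to0$ with $C_k=\bigoplus_{I_1\subsetneq\cdots\subsetneq I_k}S(-a_{\{I_1,\dots,I_k\}})$ over strictly increasing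 $k$-chains in $\Sigma$, and differential $\partial_k=\sum_{i=1}^k(-1)^iE_i$ on each summand, $E_i$ the natural inclusion into the summand indexed by the chain with $I_i$ removed. -}

module Defs where

open import Level using (Level; _⊔_) renaming (suc to lsuc)
open import Algebra.Bundles using (CommutativeRing)
open import Data.Nat as ℕ using (ℕ; zero; suc; _≤_; _<_)
import Data.Nat.Properties as ℕP
open import Data.Bool using (Bool)
import Data.Bool.Properties as BoolP
open import Data.Fin using (Fin; toℕ)
open import Data.Fin.Subset using (Subset; _∈_; _∉_; _⊆_; _⊂_; _∪_; Nonempty)
open import Data.Vec using (Vec; []; _∷_; lookup; zipWith; replicate; foldr; removeAt)
import Data.Vec.Properties as VecP
open import Data.List using (List; []; _∷_; map; concatMap; allFin)
import Data.List.Membership.Propositional as ListMem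
open import Data.List.Relation.Unary.All using (All)
open import Data.Product using (Σ; ∃; ∃-syntax; _×_; _,_; proj₁; proj₂)
open import Data.Unit using (⊤)
open import Data.Empty using (⊥)
open import Function.Bundles using (_⇔_)
open import Relation.Nullary using (¬_; yes; no)
open import Relation.Binary.PropositionalEquality using (_≡_; _≢_)

record Field (c ℓ : Level) : Set (lsuc (c ⊔ ℓ)) where
  field
    commutativeRing : CommutativeRing c ℓ
  open CommutativeRing commutativeRing public
  field
    0≉1     : ¬ (0# ≈ 1#)
    inverse : ∀ x → ¬ (x ≈ 0#) → ∃[ y ] (x * y ≈ 1#)

Mono : ℕ → Set
Mono n = Vec ℕ n

_∣ᵐ_ : ∀ {n} → Mono n → Mono n → Set
_∣ᵐ_ {n} a b = ∀ (i : Fin n) → lookup a i ≤ lookup b i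

lcmᵐ : ∀ {n} → Mono n → Mono n → Mono n
lcmᵐ = zipWith ℕ._⊔_

_*ᵐ_ : ∀ {n} → Mono n → Mono n → Mono n
_*ᵐ_ = zipWith ℕ._+_

_∸ᵐ_ : ∀ {n} → Mono n → Mono n → Mono n
_∸ᵐ_ = zipWith ℕ._∸_

oneᵐ : ∀ {n} → Mono n
oneᵐ = replicate _ 0

-- A family {m_I | I ∈ Sig}: Sig is a (finite) list of subsets of
-- {1..n} (duplicates are irrelevant: only membership is used), and
-- ν I is the exponent vector of m_I, i.e. (ν I)_i = ν_I(i).

module _ {n : ℕ} (Sig : List (Subset n)) (ν : Subset n → Mono n) where
  open ListMem using () renaming (_∈_ to _∈Σ_)

  record MonotoneFamily : Set where
    field
      nonempty : ∀ {I} → I ∈Σ Sig → Nonempty I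
      MM1 : ∀ {I} → I ∈Σ Sig → ∀ (i : Fin n) → i ∉ I → lookup (ν I) i ≡ 0
      MM2 : ∀ {I J} → I ∈Σ Sig → J ∈Σ Sig → I ⊆ J →
            ∀ {i} → i ∈ I → lookup (ν J) i ≤ lookup (ν I) i
      MM3 : ∀ {I J} → I ∈Σ Sig → J ∈Σ Sig →
            ∃[ K ] (K ∈Σ Sig × (I ∪ J) ⊆ K × ν K ∣ᵐ lcmᵐ (ν I) (ν J))

  record StrictlyMonotone : Set where
    field
      SM1 : ∀ {I J} → I ∈Σ Sig → J ∈Σ Sig → I ≢ J → ¬ (ν I ∣ᵐ ν J)
      SM2 : ∀ {I J K} → I ∈Σ Sig → J ∈Σ Sig → K ∈Σ Sig → I ⊂ J → J ⊂ K →
            ∃[ i ] (i ∈ J × i ∉ I × lookup (ν K) i < lookup (ν J) i)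

module OrderComplex {c ℓ} (𝕂 : Field c ℓ) {n : ℕ}
                    (Sig : List (Subset n)) (ν : Subset n → Mono n) where
  open Field 𝕂
  open ListMem using () renaming (_∈_ to _∈Σ_)

  -- k-chains I_1 ⊊ ⋯ ⊊ I_k (listed from I_1), as vectors of subsets
  Chain : ℕ → Set
  Chain k = Vec (Subset n) k

  Increasing : ∀ {k} → Chain k → Set
  Increasing []           = ⊤
  Increasing (I ∷ [])     = ⊤
  Increasing (I ∷ J ∷ U)  = I ⊂ J × Increasing (J ∷ U)

  ValidChain : ∀ {k} → Chain k → Set
  ValidChain U = Data.Vec.Relation.Unary.All.All (_∈Σ Sig) U × Increasing U
    where import Data.Vec.Relation.Unary.All

  a : ∀ {k} → Chain k → Mono n
  a = foldr _ (λ I acc → lcmᵐ (ν I) acc) oneᵐ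

  -- An element of C_k = ⊕_U S(-a_U) is a finite K-linear combination of
  -- terms  r · x^c · e_U  (r ∈ K, U a k-chain, c ∈ ℕ^n); e_U is the
  -- generator of S(-a_U).  C_0 = S (the only 0-chain is []).
  Elem : ℕ → Set c
  Elem k = List (Carrier × Chain k × Mono n)

  Valid : ∀ {k} → Elem k → Set c
  Valid z = All (λ t → ValidChain (proj₁ (proj₂ t))) z

  coeff : ∀ {k} → Elem k → Chain k → Mono n → Carrier
  coeff []                 U c = 0#
  coeff ((r , V , d) ∷ z)  U c with VecP.≡-dec (VecP.≡-dec BoolP._≟_) V U
                                   | VecP.≡-dec ℕP._≟_ d c
  ... | yes _ | yes _ = r + coeff z U c
  ... | _     | _     = coeff z U c

  _≈E_ : ∀ {k} → Elem k → Elem k → Set ℓ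
  z ≈E w = ∀ U c → coeff z U c ≈ coeff w U c

  sgn : ℕ → Carrier → Carrier
  sgn zero    r = r
  sgn (suc j) r = - sgn j r

  -- ∂_k = Σ_{i=1}^k (-1)^i E_i, E_i the natural inclusion
  -- S(-a_U) → S(-a_{U∖I_i}),  e_U ↦ x^{a_U - a_{U∖I_i}} e_{U∖I_i}.
  -- Index j : Fin k corresponds to i = j+1.
  ∂ : ∀ {k} → Elem (suc k) → Elem k
  ∂ {k} = concatMap λ { (r , U , c) →
            map (λ j → sgn (suc (toℕ j)) r , removeAt U j ,
                       (c *ᵐ (a U ∸ᵐ a (removeAt U j))))
                (allFin (suc k)) }

  InIdeal : Elem 0 → Set (c ⊔ ℓ)
  InIdeal f = Σ (List (Carrier × Subset n × Mono n)) λ gs → (All (λ g → proj₁ (proj₂ g) ∈Σ Sig) gs ×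
                       f ≈E map (λ { (r , J , d) → r , [] , (d *ᵐ ν J) }) gs)

  -- C_* is a free resolution of the ideal 𝓘 (via ∂_1 : C_1 → 𝓘 ⊆ S):
  -- it is a complex, ∂_1 maps C_1 onto 𝓘, and it is exact at each C_k, k ≥ 1.
  record IsFreeResolution : Set (c ⊔ ℓ) where
    field
      complex : ∀ k (z : Elem (suc (suc k))) → Valid z → ∂ (∂ z) ≈E []
      image₁  : ∀ (f : Elem 0) →
                InIdeal f ⇔ (∃[ w ] (Valid {1} w × ∂ w ≈E f))
      exact   : ∀ k (z : Elem (suc k)) → Valid z → ∂ z ≈E [] →
                ∃[ w ] (Valid {suc (suc k)} w × ∂ w ≈E z)

  -- Minimality of the resolution C_{≥1} → 𝓘:
  -- ∂_k(C_k) ⊆ 𝔪 C_{k-1} for all k ≥ 2, where 𝔪 = ⟨x_1,…,x_n⟩; an element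
  -- of a free module lies in 𝔪F iff all its coordinates have zero constant term.
  IsMinimal : Set (c ⊔ ℓ)
  IsMinimal = ∀ k (z : Elem (suc (suc k))) → Valid z →
              ∀ U → coeff (∂ z) U oneᵐ ≈ 0#

-- In multidegree b, the terms x^(b - a_U) e_U with a_U ∣ x^b span a copy of the augmented
-- order complex of Σ_b = {I ∈ Σ | m_I ∣ x^b} over 𝕂, and ∂ preserves each such strand. By
-- (MM3) a nonempty Σ_b has a largest element T, containing every member of Σ_b, so its order
-- complex is a cone with apex T: appending T to the chains that do not end in T is a
-- contracting homotopy h with ∂h + h∂ = id in positive length. Hence C_* is exact in positive
-- degrees, while ∂₁ e_I = -m_I shows that ∂₁ maps onto the ideal. For minimality, (SM1) and
-- (SM2), together with (MM1) and (MM2), show that deleting any member of a chain of length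
-- at least 2 strictly lowers some exponent of the lcm, so ∂_k (k ≥ 2) has no unit entries.

module Submission where

open import Defs
open import Level using (Level; _⊔_)
open import Algebra.Bundles using (AbelianGroup)
open import Algebra.Morphism.Structures using (module MonoidMorphisms)
open import Data.Bool using (Bool; true; false; if_then_else_)
import Data.Bool.Properties as BoolP
open import Data.Empty using (⊥-elim)
open import Data.Fin as Fin using (Fin; toℕ)
import Data.Fin.Properties as FinP
open import Data.Fin.Subset as Subset using (Subset; _⊆_; _⊂_)
import Data.Fin.Subset.Properties as SubsetP
open import Data.List as List using (List; []; _∷_; _++_; map; concatMap; length)
import Data.List.Properties as ListP
open import Data.List.Membership.Propositional using (_∈_)
open import Data.List.Relation.Binary.Pointwise as Pointwise using (Pointwise; []; _∷_)
open import Data.List.Relation.Unary.All as All using (All; []; _∷_)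
import Data.List.Relation.Unary.All.Properties as AllP
open import Data.List.Relation.Unary.Any using (here; there)
open import Data.Maybe using (Maybe; just; maybe′)
open import Data.Nat as ℕ using (ℕ; zero; suc; _≤_; _<_; z≤n; s≤s)
import Data.Nat.Properties as ℕP
open import Data.Product as Product using (_×_; _,_; proj₁; proj₂; ∃)
import Data.Product.Properties as ProductP
open import Data.Vec as Vec using (Vec; []; _∷_; lookup; tabulate; _∷ʳ_)
import Data.Vec.Properties as VecP
import Data.Vec.Relation.Unary.All as VAll
import Data.Vec.Relation.Unary.All.Properties as VAllP
open import Function using (_∘_; id)
open import Function.Bundles using (_⇔_; mk⇔)
open import Relation.Binary.Bundles using (Setoid)
open import Relation.Binary.Definitions using (DecidableEquality)
open import Relation.Binary.PropositionalEquality as ≡ using (_≡_; _≢_)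
open import Relation.Binary.Structures using (IsEquivalence)
open import Relation.Nullary using (Dec; yes; no; does; ¬_)
open import Relation.Nullary.Decidable as Decidable using (_×-dec_; _→-dec_)
open import Relation.Unary using () renaming (Decidable to Decidable₁)

module FormalSum {c ℓ} (G : AbelianGroup c ℓ) where
  open AbelianGroup G
    renaming (_∙_ to _+_; ε to 0#; _⁻¹ to -_; ∙-cong to +-cong;
              assoc to +-assoc; comm to +-comm; identityˡ to +-identityˡ;
              identityʳ to +-identityʳ; inverseˡ to -‿inverseˡ)
  open import Algebra.Properties.CommutativeSemigroup commutativeSemigroup
    using () renaming (interchange to +-interchange)

  Sum : ∀ {b} → Set b → Set (c ⊔ b)
  Sum B = List (Carrier × B)

  _≋_ : ∀ {b} {B : Set b} → Sum B → Sum B → Set (c ⊔ ℓ ⊔ b)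
  _≋_ = Pointwise λ (r , x) (s , y) → r ≈ s × x ≡ y

  module Coefficients {b} {B : Set b} (_≟_ : DecidableEquality B) where

    coeff : Sum B → B → Carrier
    coeff []            y = 0#
    coeff ((r , x) ∷ z) y with x ≟ y
    ... | yes _ = r + coeff z y
    ... | no  _ = coeff z y

    coeff-here : ∀ r {x y} z → x ≡ y → coeff ((r , x) ∷ z) y ≡ r + coeff z y
    coeff-here r {x} z ≡.refl with x ≟ x
    ... | yes _  = ≡.refl
    ... | no x≢x = ⊥-elim (x≢x ≡.refl)

    coeff-there : ∀ r {x y} z → x ≢ y → coeff ((r , x) ∷ z) y ≡ coeff z y
    coeff-there r {x} {y} z x≢y with x ≟ y
    ... | yes x≡y = ⊥-elim (x≢y x≡y)
    ... | no _    = ≡.refl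

    coeff-++ : ∀ z w y → coeff (z ++ w) y ≈ coeff z y + coeff w y
    coeff-++ []            w y = sym (+-identityˡ _)
    coeff-++ ((r , x) ∷ z) w y with x ≟ y
    ... | yes _ = trans (+-cong refl (coeff-++ z w y)) (sym (+-assoc _ _ _))
    ... | no  _ = coeff-++ z w y

    coeff-∉ : ∀ {y} z → All (λ (_ , x) → x ≢ y) z → coeff z y ≈ 0#
    coeff-∉ []            []          = refl
    coeff-∉ ((r , x) ∷ z) (x≢y ∷ z∌y) = trans (reflexive (coeff-there r z x≢y)) (coeff-∉ z z∌y)

    infix 4 _≈ₛ_
    record _≈ₛ_ (z w : Sum B) : Set (ℓ ⊔ b) where
      constructor coeffwise
      field coeff-≈ : ∀ y → coeff z y ≈ coeff w y
    open _≈ₛ_ public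

    ≈ₛ-isEquivalence : IsEquivalence _≈ₛ_
    ≈ₛ-isEquivalence = record
      { refl  = coeffwise λ _ → refl
      ; sym   = λ z≈w → coeffwise λ y → sym (coeff-≈ z≈w y)
      ; trans = λ z≈w w≈v → coeffwise λ y → trans (coeff-≈ z≈w y) (coeff-≈ w≈v y)
      }

    ≈ₛ-setoid : Setoid (c ⊔ b) (ℓ ⊔ b)
    ≈ₛ-setoid = record { isEquivalence = ≈ₛ-isEquivalence }

    open IsEquivalence ≈ₛ-isEquivalence public
      using () renaming (refl to ≈ₛ-refl; sym to ≈ₛ-sym; trans to ≈ₛ-trans; reflexive to ≈ₛ-reflexive)

    ∷-cong : ∀ {r s x z w} → r ≈ s → z ≈ₛ w → (r , x) ∷ z ≈ₛ (s , x) ∷ w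
    ∷-cong {r} {s} {x} {z} {w} r≈s z≈w = coeffwise go
      where
      go : ∀ y → coeff ((r , x) ∷ z) y ≈ coeff ((s , x) ∷ w) y
      go y with x ≟ y
      ... | yes _ = +-cong r≈s (coeff-≈ z≈w y)
      ... | no  _ = coeff-≈ z≈w y

    ≋⇒≈ₛ : ∀ {z w} → z ≋ w → z ≈ₛ w
    ≋⇒≈ₛ []                     = ≈ₛ-refl
    ≋⇒≈ₛ ((r≈s , ≡.refl) ∷ z≋w) = ∷-cong r≈s (≋⇒≈ₛ z≋w)

    ++-cong : ∀ {z z′ w w′} → z ≈ₛ z′ → w ≈ₛ w′ → z ++ w ≈ₛ z′ ++ w′
    ++-cong {z} {z′} {w} {w′} z≈z′ w≈w′ = coeffwise λ y →
      trans (coeff-++ z w y)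
        (trans (+-cong (coeff-≈ z≈z′ y) (coeff-≈ w≈w′ y)) (sym (coeff-++ z′ w′ y)))

    ++-comm : ∀ z w → z ++ w ≈ₛ w ++ z
    ++-comm z w = coeffwise λ y →
      trans (coeff-++ z w y) (trans (+-comm _ _) (sym (coeff-++ w z y)))

    ++-identityʳ : ∀ z → z ++ [] ≈ₛ z
    ++-identityʳ z = ≈ₛ-reflexive (ListP.++-identityʳ z)

    ++-commute-front : ∀ z w v → z ++ (w ++ v) ≈ₛ w ++ (z ++ v)
    ++-commute-front z w v = begin
      z ++ (w ++ v)  ≡⟨ ListP.++-assoc z w v ⟨
      (z ++ w) ++ v  ≈⟨ ++-cong (++-comm z w) ≈ₛ-refl ⟩
      (w ++ z) ++ v  ≡⟨ ListP.++-assoc w z v ⟩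
      w ++ (z ++ v)  ∎
      where open import Relation.Binary.Reasoning.Setoid ≈ₛ-setoid

    ++-interchange : ∀ z w u v → (z ++ w) ++ (u ++ v) ≈ₛ (z ++ u) ++ (w ++ v)
    ++-interchange z w u v = begin
      (z ++ w) ++ (u ++ v)  ≡⟨ ListP.++-assoc z w (u ++ v) ⟩
      z ++ (w ++ (u ++ v))  ≈⟨ ++-cong (≈ₛ-refl {z}) (++-commute-front w u v) ⟩
      z ++ (u ++ (w ++ v))  ≡⟨ ListP.++-assoc z u (w ++ v) ⟨
      (z ++ u) ++ (w ++ v)  ∎
      where open import Relation.Binary.Reasoning.Setoid ≈ₛ-setoid

    fixes-sums : ∀ {p} {P : Carrier × B → Set p} (f : Sum B → Sum B) →
                 f [] ≈ₛ [] → (∀ z w → f (z ++ w) ≈ₛ f z ++ f w) →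
                 (∀ {t} → P t → f (t ∷ []) ≈ₛ t ∷ []) → ∀ {z} → All P z → f z ≈ₛ z
    fixes-sums f f[] f-++ f-term []                 = f[]
    fixes-sums f f[] f-++ f-term {t ∷ z} (Pt ∷ Pz) =
      ≈ₛ-trans (f-++ (t ∷ []) z) (++-cong (f-term Pt) (fixes-sums f f[] f-++ f-term Pz))

    remove : B → Sum B → Sum B
    remove x []            = []
    remove x ((r , y) ∷ z) with y ≟ x
    ... | yes _ = remove x z
    ... | no  _ = (r , y) ∷ remove x z

    remove-head : ∀ r x z → remove x ((r , x) ∷ z) ≡ remove x z
    remove-head r x z with x ≟ x
    ... | yes _  = ≡.refl
    ... | no x≢x = ⊥-elim (x≢x ≡.refl)

    length-remove : ∀ x z → length (remove x z) ≤ length z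
    length-remove x []            = z≤n
    length-remove x ((r , y) ∷ z) with y ≟ x
    ... | yes _ = ℕP.m≤n⇒m≤1+n (length-remove x z)
    ... | no  _ = s≤s (length-remove x z)

    coeff-remove-≡ : ∀ x z → coeff (remove x z) x ≈ 0#
    coeff-remove-≡ x []            = refl
    coeff-remove-≡ x ((r , y) ∷ z) with y ≟ x
    ... | yes _   = coeff-remove-≡ x z
    ... | no  y≢x = trans (reflexive (coeff-there r (remove x z) y≢x)) (coeff-remove-≡ x z)

    coeff-remove-≢ : ∀ {x y} z → x ≢ y → coeff (remove x z) y ≈ coeff z y
    coeff-remove-≢ {x} {y} [] x≢y = refl
    coeff-remove-≢ {x} {y} ((r , v) ∷ z) x≢y with v ≟ x
    ... | yes ≡.refl = trans (coeff-remove-≢ z x≢y) (reflexive (≡.sym (coeff-there r z x≢y)))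
    ... | no  _      with v ≟ y
    ...   | yes _ = +-cong refl (coeff-remove-≢ z x≢y)
    ...   | no  _ = coeff-remove-≢ z x≢y

    remove-cong : ∀ x {z w} → z ≈ₛ w → remove x z ≈ₛ remove x w
    remove-cong x {z} {w} z≈w = coeffwise go
      where
      go : ∀ y → coeff (remove x z) y ≈ coeff (remove x w) y
      go y with x ≟ y
      ... | yes ≡.refl = trans (coeff-remove-≡ x z) (sym (coeff-remove-≡ x w))
      ... | no  x≢y    = trans (coeff-remove-≢ z x≢y)
                           (trans (coeff-≈ z≈w y) (sym (coeff-remove-≢ w x≢y)))

  open MonoidMorphisms rawMonoid rawMonoid public using (IsMonoidHomomorphism)

  module Induced {a} {A : Set a} (φ : A → Carrier → Carrier) where

    infixr 8 _⊙_
    _⊙_ : ∀ {b} {B : Set b} → Carrier → List (A × B) → Sum B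
    r ⊙ L = map (λ (k , y) → φ k r , y) L

    -- All maps of the complex are of this form, with φ k r = (-1)^k r.
    induced : ∀ {b b′} {B : Set b} {B′ : Set b′} → (B → List (A × B′)) → Sum B → Sum B′
    induced L = concatMap λ (r , x) → r ⊙ L x

    induced-++ : ∀ {b b′} {B : Set b} {B′ : Set b′} (L : B → List (A × B′)) z w →
                 induced L (z ++ w) ≡ induced L z ++ induced L w
    induced-++ L = ListP.concatMap-++ _

    induced-singleton : ∀ {b b′} {B : Set b} {B′ : Set b′} (k : B → A) (g : B → B′) z →
                        induced (λ x → (k x , g x) ∷ []) z ≡ map (λ (r , x) → φ (k x) r , g x) z
    induced-singleton k g []      = ≡.refl
    induced-singleton k g (_ ∷ z) = ≡.cong (_ ∷_) (induced-singleton k g z)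

    module Additivity (φ-hom : ∀ k → IsMonoidHomomorphism (φ k)) where
      private module φ k = IsMonoidHomomorphism (φ-hom k)

      module _ {b} {B : Set b} (_≟_ : DecidableEquality B) where
        open Coefficients _≟_

        ⊙-cong : ∀ {r s} → r ≈ s → ∀ L → r ⊙ L ≈ₛ s ⊙ L
        ⊙-cong r≈s L = ≋⇒≈ₛ (Pointwise.map⁺ _ _ (Pointwise.refl (λ {(k , _)} → φ.⟦⟧-cong k r≈s , ≡.refl)))

        ⊙-+ : ∀ r s L → (r + s) ⊙ L ≈ₛ r ⊙ L ++ s ⊙ L
        ⊙-+ r s L = coeffwise λ y → trans (go L y) (sym (coeff-++ (r ⊙ L) (s ⊙ L) y))
          where
          go : ∀ L y → coeff ((r + s) ⊙ L) y ≈ coeff (r ⊙ L) y + coeff (s ⊙ L) y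
          go []            y = sym (+-identityˡ 0#)
          go ((k , x) ∷ L) y with x ≟ y
          ... | yes _ = trans (+-cong (φ.homo k r s) (go L y)) (+-interchange _ _ _ _)
          ... | no  _ = go L y

        ⊙-0 : ∀ L → 0# ⊙ L ≈ₛ []
        ⊙-0 L = coeffwise (go L)
          where
          go : ∀ L y → coeff (0# ⊙ L) y ≈ 0#
          go []            y = refl
          go ((k , x) ∷ L) y with x ≟ y
          ... | yes _ = trans (+-cong (φ.ε-homo k) (go L y)) (+-identityˡ 0#)
          ... | no  _ = go L y

        ⊙-inverse : ∀ r L → (- r) ⊙ L ++ r ⊙ L ≈ₛ []
        ⊙-inverse r L = ≈ₛ-trans (≈ₛ-sym (⊙-+ (- r) r L)) (≈ₛ-trans (⊙-cong (-‿inverseˡ r) L) (⊙-0 L))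

      module _ {b b′} {B : Set b} {B′ : Set b′}
               (_≟_ : DecidableEquality B) (_≟′_ : DecidableEquality B′) where
        private
          module S  = Coefficients _≟_
          module S′ = Coefficients _≟′_
        open S using (coeff; remove)
        open S′ using (_≈ₛ_; ≈ₛ-setoid; ≈ₛ-refl)

        induced-remove : ∀ (L : B → List (A × B′)) x z →
                         induced L z ≈ₛ coeff z x ⊙ L x ++ induced L (remove x z)
        induced-remove L x [] = ≈ₛ-sym (≈ₛ-trans (S′.++-cong (⊙-0 _≟′_ (L x)) ≈ₛ-refl) ≈ₛ-refl)
          where open S′ using (≈ₛ-sym; ≈ₛ-trans)
        induced-remove L x ((r , y) ∷ z) with y ≟ x
        ... | yes ≡.refl = begin
          r ⊙ L x ++ induced L z                                  ≈⟨ S′.++-cong ≈ₛ-refl (induced-remove L x z) ⟩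
          r ⊙ L x ++ (coeff z x ⊙ L x ++ induced L (remove x z))  ≡⟨ ListP.++-assoc (r ⊙ L x) _ _ ⟨
          (r ⊙ L x ++ coeff z x ⊙ L x) ++ induced L (remove x z)
            ≈⟨ S′.++-cong (⊙-+ _≟′_ r (coeff z x) (L x)) ≈ₛ-refl ⟨
          (r + coeff z x) ⊙ L x ++ induced L (remove x z)         ∎
          where open import Relation.Binary.Reasoning.Setoid ≈ₛ-setoid
        ... | no _ = begin
          r ⊙ L y ++ induced L z                                  ≈⟨ S′.++-cong ≈ₛ-refl (induced-remove L x z) ⟩
          r ⊙ L y ++ (coeff z x ⊙ L x ++ induced L (remove x z))
            ≈⟨ S′.++-commute-front (r ⊙ L y) (coeff z x ⊙ L x) (induced L (remove x z)) ⟩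
          coeff z x ⊙ L x ++ (r ⊙ L y ++ induced L (remove x z))  ∎
          where open import Relation.Binary.Reasoning.Setoid ≈ₛ-setoid

        -- Induction on the total length: split off all terms at one basis element on both sides.
        induced-cong : ∀ (L : B → List (A × B′)) {z w} → z S.≈ₛ w → induced L z ≈ₛ induced L w
        induced-cong L {z} {w} = bounded (length z ℕ.+ length w) z w ℕP.≤-refl
          where
          open import Relation.Binary.Reasoning.Setoid ≈ₛ-setoid

          by-removing : ∀ x {z w N} → z S.≈ₛ w → length (remove x z) ℕ.+ length (remove x w) ≤ N →
                    (∀ z w → length z ℕ.+ length w ≤ N → z S.≈ₛ w → induced L z ≈ₛ induced L w) →
                    induced L z ≈ₛ induced L w
          by-removing x {z} {w} z≈w bound ih = begin
            induced L z                                ≈⟨ induced-remove L x z ⟩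
            coeff z x ⊙ L x ++ induced L (remove x z)  ≈⟨ S′.++-cong (⊙-cong _≟′_ (S.coeff-≈ z≈w x) (L x))
                                                                      (ih _ _ bound (S.remove-cong x z≈w)) ⟩
            coeff w x ⊙ L x ++ induced L (remove x w)  ≈⟨ induced-remove L x w ⟨
            induced L w                                ∎

          bounded : ∀ N z w → length z ℕ.+ length w ≤ N → z S.≈ₛ w → induced L z ≈ₛ induced L w
          bounded _ [] [] _ _ = ≈ₛ-refl
          bounded (suc N) z@((_ , x) ∷ z′) w (s≤s bound) z≈w = by-removing x z≈w
            (≡.subst (λ v → length v ℕ.+ length (remove x w) ≤ N) (≡.sym (S.remove-head _ x z′))
              (ℕP.≤-trans (ℕP.+-mono-≤ (S.length-remove x z′) (S.length-remove x w)) bound))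
            (bounded N)
          bounded (suc N) [] w@((_ , x) ∷ w′) (s≤s bound) z≈w = by-removing x z≈w
            (≡.subst (λ v → length v ≤ N) (≡.sym (S.remove-head _ x w′))
              (ℕP.≤-trans (S.length-remove x w′) bound))
            (bounded N)
          bounded zero    (_ ∷ _) _       ()
          bounded zero    []      (_ ∷ _) ()

module _ {a p} {A : Set a} {P : A → Set p} (P? : Decidable₁ P) where

  find-just : ∀ {xs x} → List.find P? xs ≡ just x → x ∈ xs × P x
  find-just {y ∷ xs} eq with P? y
  find-just {y ∷ xs} ≡.refl | yes py = here ≡.refl , py
  ... | no _ = Product.map₁ there (find-just eq)

  find-complete : ∀ {xs x} → x ∈ xs → P x → ∃ λ y → List.find P? xs ≡ just y
  find-complete {y ∷ xs} x∈ Px with P? y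
  ... | yes _ = y , ≡.refl
  find-complete {y ∷ xs} (here ≡.refl) Px | no ¬Py = ⊥-elim (¬Py Px)
  find-complete {y ∷ xs} (there x∈xs)  Px | no _   = find-complete x∈xs Px

module _ {a p} {A : Set a} {P : A → Set p} where

  All-removeAt : ∀ {k} {xs : Vec A (suc k)} → VAll.All P xs → ∀ j → VAll.All P (Vec.removeAt xs j)
  All-removeAt (_ VAll.∷ Pxs)                Fin.zero    = Pxs
  All-removeAt (Px VAll.∷ Pxs@(_ VAll.∷ _)) (Fin.suc j) = Px VAll.∷ All-removeAt Pxs j

  All-∷ʳ : ∀ {k} {xs : Vec A k} {y} → VAll.All P xs → P y → VAll.All P (xs ∷ʳ y)
  All-∷ʳ VAll.[]          Py = Py VAll.∷ VAll.[]
  All-∷ʳ (Px VAll.∷ Pxs) Py = Px VAll.∷ All-∷ʳ Pxs Py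

module _ {n : ℕ} where

  ⊂-⊆-≢ : ∀ {I J T : Subset n} → I ⊂ J → J ⊆ T → I ≢ T
  ⊂-⊆-≢ I⊂J J⊆T I≡T = SubsetP.⊂-irref I≡T (SubsetP.⊂-⊆-trans I⊂J J⊆T)

  ⊆-≢⇒⊂ : ∀ {I T : Subset n} → I ⊆ T → I ≢ T → I ⊂ T
  ⊆-≢⇒⊂ {I} {T} I⊆T I≢T with FinP.¬∀⟶∃¬ n (λ x → x Subset.∈ T → x Subset.∈ I)
                                 (λ x → (x SubsetP.∈? T) →-dec (x SubsetP.∈? I))
                                 (λ T⊆I → I≢T (SubsetP.⊆-antisym I⊆T (λ {x} → T⊆I x)))
  ... | x , T⊈I = I⊆T , x , Decidable.decidable-stable (x SubsetP.∈? T) (λ x∉T → T⊈I (⊥-elim ∘ x∉T)) ,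
                  (λ x∈I → T⊈I (λ _ → x∈I))

module _ {n : ℕ} where

  Mono-ext : {u v : Mono n} → (∀ i → lookup u i ≡ lookup v i) → u ≡ v
  Mono-ext {u} {v} eq = begin
    u                    ≡⟨ VecP.tabulate∘lookup u ⟨
    tabulate (lookup u)  ≡⟨ VecP.tabulate-cong eq ⟩
    tabulate (lookup v)  ≡⟨ VecP.tabulate∘lookup v ⟩
    v                    ∎
    where open ≡.≡-Reasoning

  lookup-*ᵐ : ∀ (u v : Mono n) i → lookup (u *ᵐ v) i ≡ lookup u i ℕ.+ lookup v i
  lookup-*ᵐ u v i = VecP.lookup-zipWith ℕ._+_ i u v

  lookup-∸ᵐ : ∀ (u v : Mono n) i → lookup (u ∸ᵐ v) i ≡ lookup u i ℕ.∸ lookup v i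
  lookup-∸ᵐ u v i = VecP.lookup-zipWith ℕ._∸_ i u v

  lookup-lcmᵐ : ∀ (u v : Mono n) i → lookup (lcmᵐ u v) i ≡ lookup u i ℕ.⊔ lookup v i
  lookup-lcmᵐ u v i = VecP.lookup-zipWith ℕ._⊔_ i u v

  lookup-oneᵐ : ∀ i → lookup (oneᵐ {n}) i ≡ 0
  lookup-oneᵐ i = VecP.lookup-replicate i 0

  _∣ᵐ?_ : (u v : Mono n) → Dec (u ∣ᵐ v)
  u ∣ᵐ? v = FinP.all? (λ i → lookup u i ℕP.≤? lookup v i)

  ∤ᵐ-witness : (u v : Mono n) → ¬ (u ∣ᵐ v) → ∃ λ i → lookup v i < lookup u i
  ∤ᵐ-witness u v u∤v = Product.map₂ ℕP.≰⇒>
    (FinP.¬∀⟶∃¬ n (λ i → lookup u i ≤ lookup v i) (λ i → lookup u i ℕP.≤? lookup v i) u∤v)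

  lcmᵐ-oneᵐ-∸ᵐ : (u : Mono n) → lcmᵐ u oneᵐ ∸ᵐ oneᵐ ≡ u
  lcmᵐ-oneᵐ-∸ᵐ u = Mono-ext λ i → begin
    lookup (lcmᵐ u oneᵐ ∸ᵐ oneᵐ) i                  ≡⟨ lookup-∸ᵐ (lcmᵐ u oneᵐ) oneᵐ i ⟩
    lookup (lcmᵐ u oneᵐ) i ℕ.∸ lookup (oneᵐ {n}) i  ≡⟨ ≡.cong₂ ℕ._∸_ (lookup-lcmᵐ u oneᵐ i) (lookup-oneᵐ i) ⟩
    (lookup u i ℕ.⊔ lookup (oneᵐ {n}) i) ℕ.∸ 0      ≡⟨ ≡.cong (ℕ._⊔_ (lookup u i)) (lookup-oneᵐ i) ⟩
    lookup u i ℕ.⊔ 0                                ≡⟨ ℕP.⊔-identityʳ (lookup u i) ⟩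
    lookup u i                                      ∎
    where open ≡.≡-Reasoning

  ∣ᵐ-trans : {u v w : Mono n} → u ∣ᵐ v → v ∣ᵐ w → u ∣ᵐ w
  ∣ᵐ-trans u∣v v∣w i = ℕP.≤-trans (u∣v i) (v∣w i)

  oneᵐ-∣ᵐ : (u : Mono n) → oneᵐ ∣ᵐ u
  oneᵐ-∣ᵐ u i = ≡.subst (ℕ._≤ lookup u i) (≡.sym (lookup-oneᵐ i)) z≤n

  ∣ᵐ-*ᵐ : (c u : Mono n) → u ∣ᵐ (c *ᵐ u)
  ∣ᵐ-*ᵐ c u i = ≡.subst (lookup u i ≤_) (≡.sym (lookup-*ᵐ c u i)) (ℕP.m≤n+m _ _)

  ∣ᵐ-lcmᵐˡ : (u v : Mono n) → u ∣ᵐ lcmᵐ u v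
  ∣ᵐ-lcmᵐˡ u v i = ≡.subst (lookup u i ≤_) (≡.sym (lookup-lcmᵐ u v i)) (ℕP.m≤m⊔n _ _)

  ∣ᵐ-lcmᵐʳ : (u v : Mono n) → v ∣ᵐ lcmᵐ u v
  ∣ᵐ-lcmᵐʳ u v i = ≡.subst (lookup v i ≤_) (≡.sym (lookup-lcmᵐ u v i)) (ℕP.m≤n⊔m _ _)

  lcmᵐ-least : {u v w : Mono n} → u ∣ᵐ w → v ∣ᵐ w → lcmᵐ u v ∣ᵐ w
  lcmᵐ-least {u} {v} {w} u∣w v∣w i =
    ≡.subst (ℕ._≤ lookup w i) (≡.sym (lookup-lcmᵐ u v i)) (ℕP.⊔-lub (u∣w i) (v∣w i))

  *ᵐ-∸ᵐ-cancel : (c u : Mono n) → (c *ᵐ u) ∸ᵐ u ≡ c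
  *ᵐ-∸ᵐ-cancel c u = Mono-ext λ i → begin
    lookup ((c *ᵐ u) ∸ᵐ u) i                  ≡⟨ lookup-∸ᵐ (c *ᵐ u) u i ⟩
    lookup (c *ᵐ u) i ℕ.∸ lookup u i          ≡⟨ ≡.cong (ℕ._∸ lookup u i) (lookup-*ᵐ c u i) ⟩
    lookup c i ℕ.+ lookup u i ℕ.∸ lookup u i  ≡⟨ ℕP.m+n∸n≡m (lookup c i) (lookup u i) ⟩
    lookup c i                                ∎
    where open ≡.≡-Reasoning

  ∸ᵐ-*ᵐ-cancel : (b u : Mono n) → u ∣ᵐ b → (b ∸ᵐ u) *ᵐ u ≡ b
  ∸ᵐ-*ᵐ-cancel b u u∣b = Mono-ext λ i → begin
    lookup ((b ∸ᵐ u) *ᵐ u) i                  ≡⟨ lookup-*ᵐ (b ∸ᵐ u) u i ⟩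
    lookup (b ∸ᵐ u) i ℕ.+ lookup u i          ≡⟨ ≡.cong (ℕ._+ lookup u i) (lookup-∸ᵐ b u i) ⟩
    lookup b i ℕ.∸ lookup u i ℕ.+ lookup u i  ≡⟨ ℕP.m∸n+n≡m (u∣b i) ⟩
    lookup b i                                ∎
    where open ≡.≡-Reasoning

  ∸ᵐ-telescope : (b u w : Mono n) → w ∣ᵐ u → u ∣ᵐ b → (b ∸ᵐ u) *ᵐ (u ∸ᵐ w) ≡ b ∸ᵐ w
  ∸ᵐ-telescope b u w w∣u u∣b = Mono-ext λ i → begin
    lookup ((b ∸ᵐ u) *ᵐ (u ∸ᵐ w)) i                              ≡⟨ lookup-*ᵐ (b ∸ᵐ u) (u ∸ᵐ w) i ⟩
    lookup (b ∸ᵐ u) i ℕ.+ lookup (u ∸ᵐ w) i                      ≡⟨ ≡.cong₂ ℕ._+_ (lookup-∸ᵐ b u i) (lookup-∸ᵐ u w i) ⟩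
    (lookup b i ℕ.∸ lookup u i) ℕ.+ (lookup u i ℕ.∸ lookup w i)  ≡⟨ ℕP.+-∸-assoc _ (w∣u i) ⟨
    (lookup b i ℕ.∸ lookup u i) ℕ.+ lookup u i ℕ.∸ lookup w i    ≡⟨ ≡.cong (ℕ._∸ lookup w i) (ℕP.m∸n+n≡m (u∣b i)) ⟩
    lookup b i ℕ.∸ lookup w i                                    ≡⟨ lookup-∸ᵐ b w i ⟨
    lookup (b ∸ᵐ w) i                                            ∎
    where open ≡.≡-Reasoning

module Resolution {c ℓ} (𝕂 : Field c ℓ) {n : ℕ} (Sig : List (Subset n)) (ν : Subset n → Mono n) where
  open Field 𝕂
  open OrderComplex 𝕂 Sig ν
  open import Algebra.Properties.Ring ring using (-‿involutive; -0#≈0#; -‿+-comm)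

  sgn-neg : ∀ j r → sgn j (- r) ≡ - sgn j r
  sgn-neg zero    r = ≡.refl
  sgn-neg (suc j) r = ≡.cong -_ (sgn-neg j r)

  sgn-comm : ∀ i j r → sgn i (sgn j r) ≡ sgn j (sgn i r)
  sgn-comm zero    j r = ≡.refl
  sgn-comm (suc i) j r = ≡.trans (≡.cong -_ (sgn-comm i j r)) (≡.sym (sgn-neg j (sgn i r)))

  sgn-involutive : ∀ j r → sgn j (sgn j r) ≈ r
  sgn-involutive zero    r = refl
  sgn-involutive (suc j) r = trans (-‿cong (reflexive (sgn-neg j (sgn j r))))
                               (trans (-‿involutive _) (sgn-involutive j r))

  sgn-cong : ∀ j {r s} → r ≈ s → sgn j r ≈ sgn j s
  sgn-cong zero    r≈s = r≈s
  sgn-cong (suc j) r≈s = -‿cong (sgn-cong j r≈s)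

  sgn-+ : ∀ j r s → sgn j (r + s) ≈ sgn j r + sgn j s
  sgn-+ zero    r s = refl
  sgn-+ (suc j) r s = trans (-‿cong (sgn-+ j r s)) (sym (-‿+-comm _ _))

  sgn-0 : ∀ j → sgn j 0# ≈ 0#
  sgn-0 zero    = refl
  sgn-0 (suc j) = trans (-‿cong (sgn-0 j)) -0#≈0#

  private module Σₛ = FormalSum +-abelianGroup
  open Σₛ using (Sum; IsMonoidHomomorphism)

  sgn-isMonoidHomomorphism : ∀ j → IsMonoidHomomorphism (sgn j)
  sgn-isMonoidHomomorphism j = record
    { isMagmaHomomorphism = record
      { isRelHomomorphism = record { cong = sgn-cong j }
      ; homo              = sgn-+ j
      }
    ; ε-homo = sgn-0 j
    }

  open Σₛ.Induced sgn
  open Additivity sgn-isMonoidHomomorphism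

  subset-≟ : DecidableEquality (Subset n)
  subset-≟ = VecP.≡-dec BoolP._≟_

  chain-≟ : ∀ {k} → DecidableEquality (Chain k)
  chain-≟ = VecP.≡-dec subset-≟

  term-≟ : ∀ {k} → DecidableEquality (Chain k × Mono n)
  term-≟ = ProductP.≡-dec chain-≟ (VecP.≡-dec ℕP._≟_)

  module C {k} = Σₛ.Coefficients (chain-≟ {k})
  module E {k} = Σₛ.Coefficients (term-≟ {k})

  coeff-cons-≡ : ∀ {k} r (V : Chain k) e z {U d} → (V , e) ≡ (U , d) →
                 coeff ((r , V , e) ∷ z) U d ≡ r + coeff z U d
  coeff-cons-≡ r V e z ≡.refl with chain-≟ V V | VecP.≡-dec ℕP._≟_ e e
  ... | yes _ | yes _ = ≡.refl
  ... | no V≢V | _    = ⊥-elim (V≢V ≡.refl)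
  ... | yes _ | no e≢e = ⊥-elim (e≢e ≡.refl)

  coeff-cons-≢ : ∀ {k} r (V : Chain k) e z {U d} → (V , e) ≢ (U , d) →
                 coeff ((r , V , e) ∷ z) U d ≡ coeff z U d
  coeff-cons-≢ r V e z {U} {d} Ve≢Ud with chain-≟ V U | VecP.≡-dec ℕP._≟_ e d
  ... | yes ≡.refl | yes ≡.refl = ⊥-elim (Ve≢Ud ≡.refl)
  ... | no _       | _          = ≡.refl
  ... | yes _      | no _       = ≡.refl

  coeff-≡ : ∀ {k} (z : Elem k) U d → coeff z U d ≡ E.coeff z (U , d)
  coeff-≡ []                U d = ≡.refl
  coeff-≡ ((r , V , e) ∷ z) U d = by-cases (term-≟ (V , e) (U , d))
    where
    by-cases : Dec ((V , e) ≡ (U , d)) → coeff ((r , V , e) ∷ z) U d ≡ E.coeff ((r , V , e) ∷ z) (U , d)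
    by-cases (yes eq) = ≡.trans (coeff-cons-≡ r V e z eq)
                          (≡.trans (≡.cong (r +_) (coeff-≡ z U d)) (≡.sym (E.coeff-here r z eq)))
    by-cases (no ne)  = ≡.trans (coeff-cons-≢ r V e z ne)
                          (≡.trans (coeff-≡ z U d) (≡.sym (E.coeff-there r z ne)))

  ≈ₛ⇒≈E : ∀ {k} {z w : Elem k} → z E.≈ₛ w → z ≈E w
  ≈ₛ⇒≈E {z = z} {w} z≈w U d =
    ≡.subst₂ _≈_ (≡.sym (coeff-≡ z U d)) (≡.sym (coeff-≡ w U d)) (E.coeff-≈ z≈w (U , d))

  ≈E⇒≈ₛ : ∀ {k} {z w : Elem k} → z ≈E w → z E.≈ₛ w
  ≈E⇒≈ₛ {z = z} {w} z≈w = E.coeffwise λ (U , d) →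
    ≡.subst₂ _≈_ (coeff-≡ z U d) (coeff-≡ w U d) (z≈w U d)

  ∣ᵐ-a : ∀ {k} (U : Chain k) → VAll.All (λ I → ν I ∣ᵐ a U) U
  ∣ᵐ-a []      = VAll.[]
  ∣ᵐ-a (I ∷ U) = ∣ᵐ-lcmᵐˡ (ν I) (a U) VAll.∷
                 VAll.map (λ {J} ν∣a → ∣ᵐ-trans {u = ν J} {a U} {a (I ∷ U)} ν∣a (∣ᵐ-lcmᵐʳ (ν I) (a U))) (∣ᵐ-a U)

  a-∣ᵐ : ∀ {k} b (U : Chain k) → VAll.All (λ I → ν I ∣ᵐ b) U → a U ∣ᵐ b
  a-∣ᵐ b []      VAll.[]          = oneᵐ-∣ᵐ b
  a-∣ᵐ b (I ∷ U) (ν∣b VAll.∷ U∣b) = lcmᵐ-least {u = ν I} {a U} {b} ν∣b (a-∣ᵐ b U U∣b)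

  -- The order complex with scalar coefficients

  -- Each face comes with its sign exponent i in ∂ = Σᵢ (-1)^i Eᵢ (see faces-tabulate).
  members-∣ᵐ : ∀ {k} b (U : Chain k) → a U ∣ᵐ b → VAll.All (λ I → ν I ∣ᵐ b) U
  members-∣ᵐ b U aU∣b = VAll.map (λ {I} ν∣a → ∣ᵐ-trans {u = ν I} {a U} {b} ν∣a aU∣b) (∣ᵐ-a U)

  faces : ∀ {k} → Chain (suc k) → List (ℕ × Chain k)
  faces (I ∷ [])    = (1 , []) ∷ []
  faces (I ∷ J ∷ U) = (1 , J ∷ U) ∷ map (λ (j , W) → suc j , I ∷ W) (faces (J ∷ U))

  faces-tabulate : ∀ {k} (U : Chain (suc k)) → faces U ≡ List.tabulate (λ j → suc (toℕ j) , Vec.removeAt U j)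
  faces-tabulate (I ∷ [])    = ≡.refl
  faces-tabulate (I ∷ J ∷ U) = ≡.cong ((1 , J ∷ U) ∷_)
    (≡.trans (≡.cong (map shift) (faces-tabulate (J ∷ U)))
      (ListP.map-tabulate (λ j → suc (toℕ j) , Vec.removeAt (J ∷ U) j) shift))
    where
    shift : ℕ × Chain _ → ℕ × Chain _
    shift (j , W) = suc j , I ∷ W

  All-faces : ∀ {k p} {P : Subset n → Set p} (U : Chain (suc k)) → VAll.All P U →
              All (λ (_ , W) → VAll.All P W) (faces U)
  All-faces U P-U = ≡.subst (All _) (≡.sym (faces-tabulate U))
    (AllP.tabulate⁺ {f = λ j → suc (toℕ j) , Vec.removeAt U j} (All-removeAt P-U))

  a-removeAt-∣ᵐ : ∀ {k} (U : Chain (suc k)) j → a (Vec.removeAt U j) ∣ᵐ a U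
  a-removeAt-∣ᵐ U j = a-∣ᵐ (a U) (Vec.removeAt U j) (All-removeAt (∣ᵐ-a U) j)

  faces-∷ʳ : ∀ {k} T (U : Chain (suc k)) →
             faces (U ∷ʳ T) ≡ map (λ (j , W) → j , W ∷ʳ T) (faces U) List.∷ʳ (suc (suc k) , U)
  faces-∷ʳ T (I ∷ [])    = ≡.refl
  faces-∷ʳ T (I ∷ J ∷ U) = ≡.cong ((1 , (J ∷ U) ∷ʳ T) ∷_) (begin
    map shift (faces ((J ∷ U) ∷ʳ T))                           ≡⟨ ≡.cong (map shift) (faces-∷ʳ T (J ∷ U)) ⟩
    map shift (map snoc (faces (J ∷ U)) List.∷ʳ _)             ≡⟨ ListP.map-++ shift (map snoc (faces (J ∷ U))) _ ⟩
    map shift (map snoc (faces (J ∷ U))) List.∷ʳ _             ≡⟨ ≡.cong (List._∷ʳ _) (ListP.map-∘ (faces (J ∷ U))) ⟨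
    map (shift ∘ snoc) (faces (J ∷ U)) List.∷ʳ _               ≡⟨ ≡.cong (List._∷ʳ _) (ListP.map-∘ (faces (J ∷ U))) ⟩
    map snoc (map shift (faces (J ∷ U))) List.∷ʳ _             ∎)
    where
    open ≡.≡-Reasoning
    shift : ∀ {m} → ℕ × Chain m → ℕ × Chain (suc m)
    shift (j , W) = suc j , I ∷ W
    snoc : ∀ {m} → ℕ × Chain m → ℕ × Chain (suc m)
    snoc (j , W) = j , W ∷ʳ T

  ∂ᶜ : ∀ {k} → Sum (Chain (suc k)) → Sum (Chain k)
  ∂ᶜ = induced faces

  prefix : ∀ {k} → Subset n → Chain k → List (ℕ × Chain (suc k))
  prefix I W = (1 , I ∷ W) ∷ []

  -- Prepending negates: every face index of I ∷ U is one more than in U (⊙-faces-∷).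
  infixr 6 _◁_
  _◁_ : ∀ {k} → Subset n → Sum (Chain k) → Sum (Chain (suc k))
  I ◁ z = induced (prefix I) z

  ⊙-faces-∷ : ∀ {k} s I (U : Chain (suc k)) → s ⊙ faces (I ∷ U) ≡ (- s , U) ∷ I ◁ (s ⊙ faces U)
  ⊙-faces-∷ s I (J ∷ U) = ≡.cong ((- s , J ∷ U) ∷_) (begin
    s ⊙ map (λ (j , W) → suc j , I ∷ W) (faces (J ∷ U))  ≡⟨ ListP.map-∘ (faces (J ∷ U)) ⟨
    map (λ (j , W) → - sgn j s , I ∷ W) (faces (J ∷ U))  ≡⟨ ListP.map-∘ (faces (J ∷ U)) ⟩
    map (λ (r , W) → - r , I ∷ W) (s ⊙ faces (J ∷ U))    ≡⟨ induced-singleton (λ _ → 1) (I ∷_) (s ⊙ faces (J ∷ U)) ⟨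
    I ◁ (s ⊙ faces (J ∷ U))                               ∎)
    where open ≡.≡-Reasoning

  ∂ᶜ-◁₀ : ∀ I (z : Sum (Chain 0)) → ∂ᶜ (I ◁ z) C.≈ₛ z
  ∂ᶜ-◁₀ I []             = C.≈ₛ-refl
  ∂ᶜ-◁₀ I ((r , []) ∷ z) = C.∷-cong (-‿involutive r) (∂ᶜ-◁₀ I z)

  ∂ᶜ-◁ : ∀ {k} I s (L : List (ℕ × Chain (suc k))) →
         ∂ᶜ (I ◁ (s ⊙ L)) C.≈ₛ s ⊙ L ++ I ◁ ∂ᶜ ((- s) ⊙ L)
  ∂ᶜ-◁ I s []            = C.≈ₛ-refl
  ∂ᶜ-◁ I s ((j , W) ∷ L) = begin
    (- sgn j s) ⊙ faces (I ∷ W) ++ ∂ᶜ (I ◁ (s ⊙ L))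
      ≡⟨ ≡.cong (_++ ∂ᶜ (I ◁ (s ⊙ L))) (⊙-faces-∷ (- sgn j s) I W) ⟩
    (- - sgn j s , W) ∷ (I ◁ (- sgn j s) ⊙ faces W ++ ∂ᶜ (I ◁ (s ⊙ L)))
      ≈⟨ C.∷-cong (-‿involutive _) (C.++-cong C.≈ₛ-refl (∂ᶜ-◁ I s L)) ⟩
    (sgn j s , W) ∷ (I ◁ (- sgn j s) ⊙ faces W ++ (s ⊙ L ++ I ◁ ∂ᶜ ((- s) ⊙ L)))
      ≈⟨ C.∷-cong refl (C.++-commute-front (I ◁ (- sgn j s) ⊙ faces W) (s ⊙ L) _) ⟩
    (sgn j s , W) ∷ (s ⊙ L ++ (I ◁ (- sgn j s) ⊙ faces W ++ I ◁ ∂ᶜ ((- s) ⊙ L)))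
      ≡⟨ ≡.cong (λ v → (sgn j s , W) ∷ (s ⊙ L ++ v)) (induced-++ (prefix I) ((- sgn j s) ⊙ faces W) _) ⟨
    (sgn j s , W) ∷ (s ⊙ L ++ I ◁ ((- sgn j s) ⊙ faces W ++ ∂ᶜ ((- s) ⊙ L)))
      ≡⟨ ≡.cong (λ r → (sgn j s , W) ∷ (s ⊙ L ++ I ◁ (r ⊙ faces W ++ ∂ᶜ ((- s) ⊙ L)))) (sgn-neg j s) ⟨
    (sgn j s , W) ∷ (s ⊙ L ++ I ◁ (sgn j (- s) ⊙ faces W ++ ∂ᶜ ((- s) ⊙ L)))
      ∎
    where open import Relation.Binary.Reasoning.Setoid C.≈ₛ-setoid

  ∂ᶜ-⊙-faces : ∀ {k} s (U : Chain (suc (suc k))) → ∂ᶜ (s ⊙ faces U) C.≈ₛ []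
  ∂ᶜ-◁-⊙-faces : ∀ {k} I s (U : Chain (suc k)) → ∂ᶜ (I ◁ (s ⊙ faces U)) C.≈ₛ s ⊙ faces U

  ∂ᶜ-⊙-faces s (I ∷ U) = begin
    ∂ᶜ (s ⊙ faces (I ∷ U))                     ≡⟨ ≡.cong ∂ᶜ (⊙-faces-∷ s I U) ⟩
    (- s) ⊙ faces U ++ ∂ᶜ (I ◁ (s ⊙ faces U))  ≈⟨ C.++-cong C.≈ₛ-refl (∂ᶜ-◁-⊙-faces I s U) ⟩
    (- s) ⊙ faces U ++ s ⊙ faces U             ≈⟨ ⊙-inverse chain-≟ s (faces U) ⟩
    []                                         ∎
    where open import Relation.Binary.Reasoning.Setoid C.≈ₛ-setoid

  ∂ᶜ-◁-⊙-faces {zero}  I s U = ∂ᶜ-◁₀ I (s ⊙ faces U)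
  ∂ᶜ-◁-⊙-faces {suc k} I s U = begin
    ∂ᶜ (I ◁ (s ⊙ faces U))                   ≈⟨ ∂ᶜ-◁ I s (faces U) ⟩
    s ⊙ faces U ++ I ◁ ∂ᶜ ((- s) ⊙ faces U)  ≈⟨ C.++-cong C.≈ₛ-refl
                                                  (induced-cong chain-≟ chain-≟ (prefix I) (∂ᶜ-⊙-faces (- s) U)) ⟩
    s ⊙ faces U ++ []                        ≈⟨ C.++-identityʳ _ ⟩
    s ⊙ faces U                              ∎
    where open import Relation.Binary.Reasoning.Setoid C.≈ₛ-setoid

  ∂ᶜ∘∂ᶜ : ∀ {k} (z : Sum (Chain (suc (suc k)))) → ∂ᶜ (∂ᶜ z) C.≈ₛ []
  ∂ᶜ∘∂ᶜ []            = C.≈ₛ-refl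
  ∂ᶜ∘∂ᶜ ((s , U) ∷ z) = C.≈ₛ-trans (C.≈ₛ-reflexive (induced-++ faces (s ⊙ faces U) (∂ᶜ z)))
                          (C.++-cong (∂ᶜ-⊙-faces s U) (∂ᶜ∘∂ᶜ z))

  endsIn : ∀ {k} → Subset n → Chain k → Bool
  endsIn T []          = false
  endsIn T (I ∷ [])    = does (subset-≟ I T)
  endsIn T (I ∷ J ∷ U) = endsIn T (J ∷ U)

  endsIn-∷ʳ : ∀ {k} T (W : Chain k) → endsIn T (W ∷ʳ T) ≡ true
  endsIn-∷ʳ T []          = Decidable.dec-true (subset-≟ T T) ≡.refl
  endsIn-∷ʳ T (I ∷ [])    = endsIn-∷ʳ T []
  endsIn-∷ʳ T (I ∷ J ∷ W) = endsIn-∷ʳ T (J ∷ W)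

  endsIn-avoiding : ∀ {k} T (U : Chain k) → VAll.All (_≢ T) U → endsIn T U ≡ false
  endsIn-avoiding T []          _                         = ≡.refl
  endsIn-avoiding T (I ∷ [])    (I≢T VAll.∷ _)           = Decidable.dec-false (subset-≟ I T) I≢T
  endsIn-avoiding T (I ∷ J ∷ U) (_ VAll.∷ J∷U≢T)         = endsIn-avoiding T (J ∷ U) J∷U≢T

  cone : ∀ {k} → Subset n → Chain k → List (ℕ × Chain (suc k))
  cone {k} T U = if endsIn T U then [] else (suc k , U ∷ʳ T) ∷ []

  hᶜ : ∀ {k} → Subset n → Sum (Chain k) → Sum (Chain (suc k))
  hᶜ T = induced (cone T)

  infixl 6 _▷_
  _▷_ : ∀ {k} → Sum (Chain k) → Subset n → Sum (Chain (suc k))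
  z ▷ T = map (λ (r , W) → r , W ∷ʳ T) z

  ⊙-▷ : ∀ {k} s (L : List (ℕ × Chain k)) T → (s ⊙ L) ▷ T ≡ s ⊙ map (λ (j , W) → j , W ∷ʳ T) L
  ⊙-▷ s L T = ≡.trans (≡.sym (ListP.map-∘ L)) (ListP.map-∘ L)

  ⊙-faces-∷ʳ : ∀ {k} s T (U : Chain (suc k)) →
               s ⊙ faces (U ∷ʳ T) ≡ (s ⊙ faces U) ▷ T ++ (sgn (suc (suc k)) s , U) ∷ []
  ⊙-faces-∷ʳ {k} s T U = begin
    s ⊙ faces (U ∷ʳ T)
      ≡⟨ ≡.cong (s ⊙_) (faces-∷ʳ T U) ⟩
    s ⊙ (map (λ (j , W) → j , W ∷ʳ T) (faces U) List.∷ʳ (k″ , U))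
      ≡⟨ ListP.map-++ _ (map _ (faces U)) _ ⟩
    s ⊙ map (λ (j , W) → j , W ∷ʳ T) (faces U) ++ (sgn k″ s , U) ∷ []
      ≡⟨ ≡.cong (_++ (sgn k″ s , U) ∷ []) (⊙-▷ s (faces U) T) ⟨
    (s ⊙ faces U) ▷ T ++ (sgn k″ s , U) ∷ []
      ∎
    where
    open ≡.≡-Reasoning
    k″ = suc (suc k)

  hᶜ-▷ : ∀ {k} T (z : Sum (Chain k)) → hᶜ T (z ▷ T) ≡ []
  hᶜ-▷ T []            = ≡.refl
  hᶜ-▷ T ((r , W) ∷ z) rewrite endsIn-∷ʳ T W = hᶜ-▷ T z

  cone-avoiding : ∀ {k} T (U : Chain k) → VAll.All (_≢ T) U → cone T U ≡ (suc k , U ∷ʳ T) ∷ []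
  cone-avoiding T U U≢T rewrite endsIn-avoiding T U U≢T = ≡.refl

  cone-∷ʳ : ∀ {k} T (W : Chain k) → cone T (W ∷ʳ T) ≡ []
  cone-∷ʳ T W rewrite endsIn-∷ʳ T W = ≡.refl

  hᶜ-⊙-avoiding : ∀ {k} s T (L : List (ℕ × Chain k)) → All (λ (_ , W) → VAll.All (_≢ T) W) L →
                  hᶜ T (s ⊙ L) ≡ (sgn (suc k) s ⊙ L) ▷ T
  hᶜ-⊙-avoiding s T []            []                = ≡.refl
  hᶜ-⊙-avoiding {k} s T ((j , W) ∷ L) (W≢T ∷ L≢T) = ≡.cong₂ _++_
    (≡.trans (≡.cong (sgn j s ⊙_) (cone-avoiding T W W≢T))
             (≡.cong (λ r → (r , W ∷ʳ T) ∷ []) (sgn-comm (suc k) j s)))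
    (hᶜ-⊙-avoiding s T L L≢T)

  data ConeView (T : Subset n) : ∀ {k} → Chain k → Set where
    ends   : ∀ {k} (W : Chain k) → VAll.All (_≢ T) W → ConeView T (W ∷ʳ T)
    avoids : ∀ {k} {U : Chain k} → VAll.All (_≢ T) U → ConeView T U

  ∷-coneView : ∀ {T k} I {U : Chain k} → I ≢ T → ConeView T U → ConeView T (I ∷ U)
  ∷-coneView I I≢T (ends W W≢T)  = ends (I ∷ W) (I≢T VAll.∷ W≢T)
  ∷-coneView I I≢T (avoids U≢T)  = avoids (I≢T VAll.∷ U≢T)

  coneView : ∀ {k} T (U : Chain (suc k)) → Increasing U → VAll.All (_⊆ T) U → ConeView T U
  coneView T (I ∷ []) _ _ with subset-≟ I T
  ... | yes ≡.refl = ends [] VAll.[]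
  ... | no  I≢T    = avoids (I≢T VAll.∷ VAll.[])
  coneView T (I ∷ J ∷ U) (I⊂J , J∷U↑) (_ VAll.∷ J∷U⊆T@(J⊆T VAll.∷ _)) =
    ∷-coneView I (⊂-⊆-≢ I⊂J J⊆T) (coneView T (J ∷ U) J∷U↑ J∷U⊆T)

  hᶜ-homotopy-ends : ∀ {k} T s (W : Chain k) → VAll.All (_≢ T) W →
    ∂ᶜ (hᶜ T ((s , W ∷ʳ T) ∷ [])) ++ hᶜ T (∂ᶜ ((s , W ∷ʳ T) ∷ [])) C.≈ₛ (s , W ∷ʳ T) ∷ []
  hᶜ-homotopy-ends T s [] _ =
    C.≈ₛ-trans (C.≈ₛ-reflexive (≡.cong (λ v → ∂ᶜ (s ⊙ v ++ []) ++ hᶜ T (∂ᶜ ((s , T ∷ []) ∷ [])))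
                                        (cone-∷ʳ T [])))
               (C.∷-cong (-‿involutive s) C.≈ₛ-refl)
  hᶜ-homotopy-ends {suc k} T s W W≢T = begin
    ∂ᶜ (s ⊙ cone T (W ∷ʳ T) ++ []) ++ hᶜ T (s ⊙ faces (W ∷ʳ T) ++ [])
      ≡⟨ ≡.cong₂ (λ u v → ∂ᶜ (s ⊙ u ++ []) ++ hᶜ T v) (cone-∷ʳ T W) (ListP.++-identityʳ (s ⊙ faces (W ∷ʳ T))) ⟩
    hᶜ T (s ⊙ faces (W ∷ʳ T))
      ≡⟨ ≡.cong (hᶜ T) (⊙-faces-∷ʳ s T W) ⟩
    hᶜ T ((s ⊙ faces W) ▷ T ++ (σ , W) ∷ [])
      ≡⟨ induced-++ (cone T) ((s ⊙ faces W) ▷ T) _ ⟩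
    hᶜ T ((s ⊙ faces W) ▷ T) ++ σ ⊙ cone T W ++ []
      ≡⟨ ≡.cong₂ (λ u v → u ++ σ ⊙ v ++ []) (hᶜ-▷ T (s ⊙ faces W)) (cone-avoiding T W W≢T) ⟩
    (sgn (suc (suc k)) σ , W ∷ʳ T) ∷ []
      ≈⟨ C.∷-cong (sgn-involutive (suc (suc k)) s) C.≈ₛ-refl ⟩
    (s , W ∷ʳ T) ∷ []
      ∎
    where
    open import Relation.Binary.Reasoning.Setoid C.≈ₛ-setoid
    σ = sgn (suc (suc k)) s

  hᶜ-homotopy-avoids : ∀ {k} T s (U : Chain (suc k)) → VAll.All (_≢ T) U →
    ∂ᶜ (hᶜ T ((s , U) ∷ [])) ++ hᶜ T (∂ᶜ ((s , U) ∷ [])) C.≈ₛ (s , U) ∷ []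
  hᶜ-homotopy-avoids {k} T s U U≢T = begin
    ∂ᶜ (s ⊙ cone T U ++ []) ++ hᶜ T (s ⊙ faces U ++ [])
      ≡⟨ ≡.cong₂ (λ u v → ∂ᶜ (s ⊙ u ++ []) ++ hᶜ T v) (cone-avoiding T U U≢T) (ListP.++-identityʳ (s ⊙ faces U)) ⟩
    (σ ⊙ faces (U ∷ʳ T) ++ []) ++ hᶜ T (s ⊙ faces U)
      ≡⟨ ≡.cong₂ (λ u v → (u ++ []) ++ v) (⊙-faces-∷ʳ σ T U) (hᶜ-⊙-avoiding s T (faces U) (All-faces U U≢T)) ⟩
    (((σ ⊙ faces U) ▷ T ++ (τ , U) ∷ []) ++ []) ++ (s′ ⊙ faces U) ▷ T
      ≡⟨ ≡.cong₂ (λ u v → ((u ++ (τ , U) ∷ []) ++ []) ++ v) (⊙-▷ σ (faces U) T) (⊙-▷ s′ (faces U) T) ⟩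
    ((σ ⊙ F′ ++ (τ , U) ∷ []) ++ []) ++ s′ ⊙ F′
      ≡⟨ ≡.cong (_++ s′ ⊙ F′) (ListP.++-identityʳ (σ ⊙ F′ ++ (τ , U) ∷ [])) ⟩
    (σ ⊙ F′ ++ (τ , U) ∷ []) ++ s′ ⊙ F′
      ≡⟨ ListP.++-assoc (σ ⊙ F′) ((τ , U) ∷ []) (s′ ⊙ F′) ⟩
    σ ⊙ F′ ++ (τ , U) ∷ s′ ⊙ F′
      ≈⟨ C.++-commute-front (σ ⊙ F′) ((τ , U) ∷ []) (s′ ⊙ F′) ⟩
    (τ , U) ∷ (σ ⊙ F′ ++ s′ ⊙ F′)
      ≈⟨ C.∷-cong (sgn-involutive (suc (suc k)) s) (⊙-inverse chain-≟ s′ F′) ⟩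
    (s , U) ∷ []
      ∎
    where
    open import Relation.Binary.Reasoning.Setoid C.≈ₛ-setoid
    s′ = sgn (suc k) s
    σ  = sgn (suc (suc k)) s
    τ  = sgn (suc (suc k)) σ
    F′ = map (λ (j , W) → j , W ∷ʳ T) (faces U)

  hᶜ-homotopy : ∀ {k} T s (U : Chain (suc k)) → Increasing U → VAll.All (_⊆ T) U →
    ∂ᶜ (hᶜ T ((s , U) ∷ [])) ++ hᶜ T (∂ᶜ ((s , U) ∷ [])) C.≈ₛ (s , U) ∷ []
  hᶜ-homotopy T s U U↑ U⊆T with coneView T U U↑ U⊆T
  ... | ends W W≢T  = hᶜ-homotopy-ends T s W W≢T
  ... | avoids U≢T  = hᶜ-homotopy-avoids T s U U≢T

  -- Multidegree strands

  -- atDegree b sends r·e_W to r·x^(b - a_W) e_W, the summand of C_* in multidegree b.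
  toDegree : ∀ {k} → Mono n → ℕ × Chain k → ℕ × Chain k × Mono n
  toDegree b (j , V) = j , V , (b ∸ᵐ a V)

  degreeTerm : ∀ {k} → Mono n → Chain k → List (ℕ × Chain k × Mono n)
  degreeTerm b W = toDegree b (0 , W) ∷ []

  atDegree : ∀ {k} → Mono n → Sum (Chain k) → Elem k
  atDegree b = induced (degreeTerm b)

  Below : ∀ {k} → Mono n → Sum (Chain k) → Set c
  Below b z = All (λ (_ , W) → a W ∣ᵐ b) z

  atDegree-cong : ∀ {k} b {z w : Sum (Chain k)} → z C.≈ₛ w → atDegree b z E.≈ₛ atDegree b w
  atDegree-cong b = induced-cong chain-≟ term-≟ (degreeTerm b)

  term-atDegree : ∀ {k} r (U : Chain k) d → (r , U , d) ∷ [] ≡ atDegree (d *ᵐ a U) ((r , U) ∷ [])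
  term-atDegree r U d = ≡.cong (λ e → (r , U , e) ∷ []) (≡.sym (*ᵐ-∸ᵐ-cancel d (a U)))

  atDegree-⊙ : ∀ {k} b s (L : List (ℕ × Chain k)) → atDegree b (s ⊙ L) ≡ s ⊙ map (toDegree b) L
  atDegree-⊙ b s L = begin
    atDegree b (s ⊙ L)                            ≡⟨ induced-singleton (λ _ → 0) (λ V → V , (b ∸ᵐ a V)) (s ⊙ L) ⟩
    map (λ (r , V) → r , V , (b ∸ᵐ a V)) (s ⊙ L)  ≡⟨ ListP.map-∘ L ⟨
    map (λ (j , V) → sgn j s , V , (b ∸ᵐ a V)) L  ≡⟨ ListP.map-∘ L ⟩
    s ⊙ map (toDegree b) L                        ∎
    where open ≡.≡-Reasoning

  ∂-atDegree : ∀ {k} b (z : Sum (Chain (suc k))) → Below b z → ∂ (atDegree b z) ≡ atDegree b (∂ᶜ z)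
  ∂-atDegree b []            []               = ≡.refl
  ∂-atDegree {k} b ((s , W) ∷ z) (aW∣b ∷ z-below) = begin
    map face (List.allFin (suc k)) ++ ∂ (atDegree b z)  ≡⟨ ≡.cong₂ _++_ faces-term (∂-atDegree b z z-below) ⟩
    atDegree b (s ⊙ faces W) ++ atDegree b (∂ᶜ z)       ≡⟨ induced-++ (degreeTerm b) (s ⊙ faces W) (∂ᶜ z) ⟨
    atDegree b (s ⊙ faces W ++ ∂ᶜ z)                    ∎
    where
    open ≡.≡-Reasoning
    face : Fin (suc k) → Carrier × Chain k × Mono n
    face j = sgn (suc (toℕ j)) s , Vec.removeAt W j , ((b ∸ᵐ a W) *ᵐ (a W ∸ᵐ a (Vec.removeAt W j)))
    faces-term : map face (List.allFin (suc k)) ≡ atDegree b (s ⊙ faces W)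
    faces-term = begin
      map face (List.allFin (suc k))
        ≡⟨ ListP.map-tabulate id face ⟩
      List.tabulate face
        ≡⟨ ListP.tabulate-cong (λ j → ≡.cong (λ e → sgn (suc (toℕ j)) s , Vec.removeAt W j , e)
                                     (∸ᵐ-telescope b (a W) (a (Vec.removeAt W j)) (a-removeAt-∣ᵐ W j) aW∣b)) ⟩
      List.tabulate (λ j → sgn (suc (toℕ j)) s , Vec.removeAt W j , (b ∸ᵐ a (Vec.removeAt W j)))
        ≡⟨ ListP.map-tabulate (λ j → suc (toℕ j) , Vec.removeAt W j , (b ∸ᵐ a (Vec.removeAt W j))) _ ⟨
      s ⊙ List.tabulate (λ j → suc (toℕ j) , Vec.removeAt W j , (b ∸ᵐ a (Vec.removeAt W j)))
        ≡⟨ ≡.cong (s ⊙_) (ListP.map-tabulate (λ j → suc (toℕ j) , Vec.removeAt W j) (toDegree b)) ⟨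
      s ⊙ map (toDegree b) (List.tabulate (λ j → suc (toℕ j) , Vec.removeAt W j))
        ≡⟨ ≡.cong (λ L → s ⊙ map (toDegree b) L) (faces-tabulate W) ⟨
      s ⊙ map (toDegree b) (faces W)
        ≡⟨ atDegree-⊙ b s (faces W) ⟨
      atDegree b (s ⊙ faces W)
        ∎

  Below-∂ᶜ : ∀ {k} b (z : Sum (Chain (suc k))) → Below b z → Below b (∂ᶜ z)
  Below-∂ᶜ b []            []            = []
  Below-∂ᶜ b ((s , W) ∷ z) (aW∣b ∷ z↓b) = AllP.++⁺ (AllP.map⁺ faces↓b) (Below-∂ᶜ b z z↓b)
    where
    faces↓b : All (λ (_ , V) → a V ∣ᵐ b) (faces W)
    faces↓b = All.map (λ {(_ , V)} → a-∣ᵐ b V) (All-faces W (members-∣ᵐ b W aW∣b))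

  ∂-++ : ∀ {k} (z w : Elem (suc k)) → ∂ (z ++ w) ≡ ∂ z ++ ∂ w
  ∂-++ = ListP.concatMap-++ _

  ∂∘∂-term : ∀ {k} r (U : Chain (suc (suc k))) d → ∂ (∂ ((r , U , d) ∷ [])) E.≈ₛ []
  ∂∘∂-term r U d = begin
    ∂ (∂ ((r , U , d) ∷ []))              ≡⟨ ≡.cong (∂ ∘ ∂) (term-atDegree r U d) ⟩
    ∂ (∂ (atDegree b ((r , U) ∷ [])))     ≡⟨ ≡.cong ∂ (∂-atDegree b _ U↓b) ⟩
    ∂ (atDegree b (∂ᶜ ((r , U) ∷ [])))    ≡⟨ ∂-atDegree b _ (Below-∂ᶜ b _ U↓b) ⟩
    atDegree b (∂ᶜ (∂ᶜ ((r , U) ∷ [])))   ≈⟨ atDegree-cong b (∂ᶜ∘∂ᶜ ((r , U) ∷ [])) ⟩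
    []                                    ∎
    where
    open import Relation.Binary.Reasoning.Setoid E.≈ₛ-setoid
    b = d *ᵐ a U
    U↓b : Below b ((r , U) ∷ [])
    U↓b = ∣ᵐ-*ᵐ d (a U) ∷ []

  ∂∘∂ : ∀ {k} (z : Elem (suc (suc k))) → ∂ (∂ z) E.≈ₛ []
  ∂∘∂ []                = E.≈ₛ-refl
  ∂∘∂ (t@(r , U , d) ∷ z) =
    E.≈ₛ-trans (E.≈ₛ-reflexive (≡.trans (≡.cong ∂ (∂-++ (t ∷ []) z)) (∂-++ (∂ (t ∷ [])) (∂ z))))
               (E.++-cong (∂∘∂-term r U d) (∂∘∂ z))

  -- The contracting homotopy

  IsTop : Mono n → Subset n → Set
  IsTop b T = ν T ∣ᵐ b × All (λ J → ν J ∣ᵐ b → J ⊆ T) Sig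

  isTop? : ∀ b → Decidable₁ (IsTop b)
  isTop? b T = (ν T ∣ᵐ? b) ×-dec All.all? (λ J → (ν J ∣ᵐ? b) →-dec (J SubsetP.⊆? T)) Sig

  top : Mono n → Maybe (Subset n)
  top b = List.find (isTop? b) Sig

  -- On a term of multidegree b, h cones off at the top of Σ_b; it vanishes if Σ_b is empty.
  homotopyTerms : ∀ {k} → Chain k × Mono n → List (ℕ × Chain (suc k) × Mono n)
  homotopyTerms (U , d) = maybe′ (λ T → map (toDegree b) (cone T U)) [] (top b)
    where b = d *ᵐ a U

  h : ∀ {k} → Elem k → Elem (suc k)
  h = induced homotopyTerms

  h-atDegree : ∀ {k} b T (z : Sum (Chain k)) → top b ≡ just T → Below b z → h (atDegree b z) ≡ atDegree b (hᶜ T z)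
  h-atDegree b T []            _     []            = ≡.refl
  h-atDegree b T ((s , W) ∷ z) top≡T (aW∣b ∷ z↓b) = begin
    s ⊙ homotopyTerms (W , b ∸ᵐ a W) ++ h (atDegree b z)  ≡⟨ ≡.cong₂ _++_ cone-term (h-atDegree b T z top≡T z↓b) ⟩
    atDegree b (s ⊙ cone T W) ++ atDegree b (hᶜ T z)      ≡⟨ induced-++ (degreeTerm b) (s ⊙ cone T W) (hᶜ T z) ⟨
    atDegree b (s ⊙ cone T W ++ hᶜ T z)                   ∎
    where
    open ≡.≡-Reasoning
    cone-term : s ⊙ homotopyTerms (W , b ∸ᵐ a W) ≡ atDegree b (s ⊙ cone T W)
    cone-term rewrite ∸ᵐ-*ᵐ-cancel b (a W) aW∣b | top≡T = ≡.sym (atDegree-⊙ b s (cone T W))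

  h-++ : ∀ {k} (z w : Elem k) → h (z ++ w) ≡ h z ++ h w
  h-++ = induced-++ homotopyTerms

  Below-hᶜ : ∀ {k} b T (z : Sum (Chain k)) → ν T ∣ᵐ b → Below b z → Below b (hᶜ T z)
  Below-hᶜ b T []            _     []            = []
  Below-hᶜ b T ((s , W) ∷ z) νT∣b (aW∣b ∷ z↓b) = AllP.++⁺ (AllP.map⁺ cone↓b) (Below-hᶜ b T z νT∣b z↓b)
    where
    cone↓b : All (λ (_ , V) → a V ∣ᵐ b) (cone T W)
    cone↓b with endsIn T W
    ... | true  = []
    ... | false = a-∣ᵐ b (W ∷ʳ T) (All-∷ʳ (members-∣ᵐ b W aW∣b) νT∣b) ∷ []

  Increasing-∷ʳ : ∀ {k} {T} (U : Chain (suc k)) → Increasing U → VAll.All (_⊂ T) U → Increasing (U ∷ʳ T)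
  Increasing-∷ʳ (I ∷ [])    _          (I⊂T VAll.∷ _)   = I⊂T , _
  Increasing-∷ʳ (I ∷ J ∷ U) (I⊂J , J∷U↑) (_ VAll.∷ J∷U⊂T) = I⊂J , Increasing-∷ʳ (J ∷ U) J∷U↑ J∷U⊂T

  record TopAbove {k} (b : Mono n) (U : Chain k) : Set where
    field
      apex     : Subset n
      top≡apex : top b ≡ just apex
      apex∈Σ   : apex ∈ Sig
      ν-apex∣b : ν apex ∣ᵐ b
      U⊆apex   : VAll.All (_⊆ apex) U

  module _ (mf : MonotoneFamily Sig ν) where
    open MonotoneFamily mf

    common-upper-bound : ∀ b {I} → I ∈ Sig → ν I ∣ᵐ b → ∀ L → All (_∈ Sig) L →
                 ∃ λ K → K ∈ Sig × ν K ∣ᵐ b × All (λ J → ν J ∣ᵐ b → J ⊆ K) L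
    common-upper-bound b I∈Σ νI∣b []      []             = _ , I∈Σ , νI∣b , []
    common-upper-bound b I∈Σ νI∣b (J ∷ L) (J∈Σ ∷ L⊆Σ)
      with common-upper-bound b I∈Σ νI∣b L L⊆Σ | ν J ∣ᵐ? b
    ... | K , K∈Σ , νK∣b , L⊆K | no νJ∤b = K , K∈Σ , νK∣b , (⊥-elim ∘ νJ∤b) ∷ L⊆K
    ... | K , K∈Σ , νK∣b , L⊆K | yes νJ∣b with MM3 K∈Σ J∈Σ
    ...   | K′ , K′∈Σ , K∪J⊆K′ , νK′∣lcm =
      K′ , K′∈Σ ,
      ∣ᵐ-trans {u = ν K′} {lcmᵐ (ν K) (ν J)} {b} νK′∣lcm (lcmᵐ-least {u = ν K} {ν J} {b} νK∣b νJ∣b) ,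
      (λ _ {x} x∈J → K∪J⊆K′ (SubsetP.q⊆p∪q K J x∈J)) ∷
      All.map (λ J′⊆K νJ′∣b {x} x∈J′ → K∪J⊆K′ (SubsetP.p⊆p∪q J (J′⊆K νJ′∣b x∈J′))) L⊆K

    top-exists : ∀ b {I} → I ∈ Sig → ν I ∣ᵐ b → ∃ λ T → top b ≡ just T
    top-exists b I∈Σ νI∣b =
      let K , K∈Σ , νK∣b , Sig⊆K = common-upper-bound b I∈Σ νI∣b Sig (All.tabulate id)
      in  find-complete (isTop? b) K∈Σ (νK∣b , Sig⊆K)

    topAbove : ∀ {k} (U : Chain (suc k)) d → ValidChain U → TopAbove (d *ᵐ a U) U
    topAbove U@(I ∷ _) d (U⊆Σ@(I∈Σ VAll.∷ _) , _) = record
      { apex     = T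
      ; top≡apex = top≡T
      ; apex∈Σ   = T∈Σ
      ; ν-apex∣b = νT∣b
      ; U⊆apex   = VAll.map (λ (J∈Σ , νJ∣b) {x} → All.lookup Σ_b⊆T J∈Σ νJ∣b) (VAll.zip (U⊆Σ , U∣b))
      }
      where
      b = d *ᵐ a U
      U∣b = members-∣ᵐ b U (∣ᵐ-*ᵐ d (a U))
      T,top≡T = top-exists b I∈Σ (VAll.head U∣b)
      T = proj₁ T,top≡T
      top≡T = proj₂ T,top≡T
      T∈Σ,isTop = find-just (isTop? b) {Sig} top≡T
      T∈Σ = proj₁ T∈Σ,isTop
      νT∣b = proj₁ (proj₂ T∈Σ,isTop)
      Σ_b⊆T = proj₂ (proj₂ T∈Σ,isTop)

    homotopy-term : ∀ {k} r (U : Chain (suc k)) d → ValidChain U →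
                    ∂ (h ((r , U , d) ∷ [])) ++ h (∂ ((r , U , d) ∷ [])) E.≈ₛ (r , U , d) ∷ []
    homotopy-term r U d U-valid@(_ , U↑) = begin
      ∂ (h t) ++ h (∂ t)
        ≡⟨ ≡.cong (λ v → ∂ (h v) ++ h (∂ v)) (term-atDegree r U d) ⟩
      ∂ (h (atDegree b z)) ++ h (∂ (atDegree b z))
        ≡⟨ ≡.cong₂ (λ u v → ∂ u ++ h v) (h-atDegree b T z top≡apex z↓b) (∂-atDegree b z z↓b) ⟩
      ∂ (atDegree b (hᶜ T z)) ++ h (atDegree b (∂ᶜ z))
        ≡⟨ ≡.cong₂ _++_ (∂-atDegree b (hᶜ T z) (Below-hᶜ b T z ν-apex∣b z↓b))
                        (h-atDegree b T (∂ᶜ z) top≡apex (Below-∂ᶜ b z z↓b)) ⟩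
      atDegree b (∂ᶜ (hᶜ T z)) ++ atDegree b (hᶜ T (∂ᶜ z))
        ≡⟨ induced-++ (degreeTerm b) (∂ᶜ (hᶜ T z)) (hᶜ T (∂ᶜ z)) ⟨
      atDegree b (∂ᶜ (hᶜ T z) ++ hᶜ T (∂ᶜ z))
        ≈⟨ atDegree-cong b (hᶜ-homotopy T r U U↑ U⊆apex) ⟩
      atDegree b z
        ≡⟨ term-atDegree r U d ⟨
      t ∎
      where
      open import Relation.Binary.Reasoning.Setoid E.≈ₛ-setoid
      t = (r , U , d) ∷ []
      b = d *ᵐ a U
      z = (r , U) ∷ []
      z↓b : Below b z
      z↓b = ∣ᵐ-*ᵐ d (a U) ∷ []
      open TopAbove (topAbove U d U-valid) renaming (apex to T)

    homotopy : ∀ {k} (z : Elem (suc k)) → Valid z → ∂ (h z) ++ h (∂ z) E.≈ₛ z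
    homotopy z = E.fixes-sums (λ z → ∂ (h z) ++ h (∂ z)) E.≈ₛ-refl additive
                   (λ {(r , U , d)} → homotopy-term r U d)
      where
      additive : ∀ z w → ∂ (h (z ++ w)) ++ h (∂ (z ++ w)) E.≈ₛ (∂ (h z) ++ h (∂ z)) ++ (∂ (h w) ++ h (∂ w))
      additive z w = E.≈ₛ-trans
        (E.≈ₛ-reflexive (≡.cong₂ _++_ (≡.trans (≡.cong ∂ (h-++ z w)) (∂-++ (h z) (h w)))
                                     (≡.trans (≡.cong h (∂-++ z w)) (h-++ (∂ z) (∂ w)))))
        (E.++-interchange (∂ (h z)) (∂ (h w)) (h (∂ z)) (h (∂ w)))

    valid-cone : ∀ {k} r T b (U : Chain (suc k)) → T ∈ Sig → VAll.All (_∈ Sig) U → Increasing U →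
                 VAll.All (_⊆ T) U → ConeView T U → Valid (r ⊙ map (toDegree b) (cone T U))
    valid-cone r T b _ _ _ _ _ (ends W _) rewrite cone-∷ʳ T W = []
    valid-cone r T b U T∈Σ U⊆Σ U↑ U⊆T (avoids U≢T) rewrite cone-avoiding T U U≢T =
      (All-∷ʳ U⊆Σ T∈Σ , Increasing-∷ʳ U U↑ U⊂T) ∷ []
      where
      U⊂T : VAll.All (_⊂ T) U
      U⊂T = VAll.map (λ (I⊆T , I≢T) → ⊆-≢⇒⊂ I⊆T I≢T) (VAll.zip (U⊆T , U≢T))

    valid-h : ∀ {k} (z : Elem (suc k)) → Valid z → Valid (h z)
    valid-h []                  []                              = []
    valid-h ((r , U , d) ∷ z) (U-valid@(U⊆Σ , U↑) ∷ z-valid) = AllP.++⁺ term-valid (valid-h z z-valid)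
      where
      open TopAbove (topAbove U d U-valid) renaming (apex to T)
      term-valid : Valid (r ⊙ homotopyTerms (U , d))
      term-valid rewrite top≡apex = valid-cone r T (d *ᵐ a U) U apex∈Σ U⊆Σ U↑ U⊆apex (coneView T U U↑ U⊆apex)

    exact : ∀ k (z : Elem (suc k)) → Valid z → ∂ z ≈E [] → ∃ λ w → Valid {suc (suc k)} w × ∂ w ≈E z
    exact k z z-valid ∂z≈0 = h z , valid-h z z-valid , ≈ₛ⇒≈E (begin
      ∂ (h z)             ≈⟨ E.++-identityʳ (∂ (h z)) ⟨
      ∂ (h z) ++ []       ≈⟨ E.++-cong (E.≈ₛ-refl {x = ∂ (h z)}) h∂z≈[] ⟨
      ∂ (h z) ++ h (∂ z)  ≈⟨ homotopy z z-valid ⟩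
      z                   ∎)
      where
      open import Relation.Binary.Reasoning.Setoid E.≈ₛ-setoid
      h∂z≈[] : h (∂ z) E.≈ₛ []
      h∂z≈[] = induced-cong term-≟ term-≟ homotopyTerms (≈E⇒≈ₛ {z = ∂ z} {[]} ∂z≈0)

  -- The image of ∂₁

  generators : List (Carrier × Subset n × Mono n) → Elem 0
  generators = map (λ (r , J , d) → r , [] , (d *ᵐ ν J))

  singletons : List (Carrier × Subset n × Mono n) → Elem 1
  singletons = map (λ (r , J , d) → - r , J ∷ [] , d)

  ∂-singletons : ∀ gs → ∂ (singletons gs) Σₛ.≋ generators gs
  ∂-singletons []              = []
  ∂-singletons ((r , J , d) ∷ gs) =
    (-‿involutive r , ≡.cong (λ e → [] , (d *ᵐ e)) (lcmᵐ-oneᵐ-∸ᵐ (ν J))) ∷ ∂-singletons gs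

  ∂₁-generators : ∀ (w : Elem 1) → ∂ w Σₛ.≋ generators (map (λ (r , U , d) → - r , Vec.head U , d) w)
  ∂₁-generators []                     = []
  ∂₁-generators ((r , J ∷ [] , d) ∷ w) =
    (refl , ≡.cong (λ e → [] , (d *ᵐ e)) (lcmᵐ-oneᵐ-∸ᵐ (ν J))) ∷ ∂₁-generators w

  image-∂₁ : ∀ f → InIdeal f ⇔ (∃ λ w → Valid {1} w × ∂ w ≈E f)
  image-∂₁ f = mk⇔ to from
    where
    to : InIdeal f → ∃ λ w → Valid {1} w × ∂ w ≈E f
    to (gs , gs⊆Σ , f≈gs) = singletons gs ,
      AllP.map⁺ (All.map (λ J∈Σ → (J∈Σ VAll.∷ VAll.[]) , _) gs⊆Σ) ,
      ≈ₛ⇒≈E {z = ∂ (singletons gs)} {f} (E.≈ₛ-trans (E.≋⇒≈ₛ (∂-singletons gs)) (E.≈ₛ-sym (≈E⇒≈ₛ {z = f} f≈gs)))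
    from : (∃ λ w → Valid {1} w × ∂ w ≈E f) → InIdeal f
    from (w , w-valid , ∂w≈f) = map (λ (r , U , d) → - r , Vec.head U , d) w ,
      AllP.map⁺ (All.map (λ { {_ , _ ∷ [] , _} ((J∈Σ VAll.∷ _) , _) → J∈Σ }) w-valid) ,
      ≈ₛ⇒≈E {z = f} (E.≈ₛ-trans (E.≈ₛ-sym (≈E⇒≈ₛ {z = ∂ w} ∂w≈f)) (E.≋⇒≈ₛ (∂₁-generators w)))

  -- Minimality

  module _ (mf : MonotoneFamily Sig ν) (sm : StrictlyMonotone Sig ν) where
    open MonotoneFamily mf
    open StrictlyMonotone sm

    ∈-support : ∀ {I} → I ∈ Sig → ∀ {i x} → x < lookup (ν I) i → i Subset.∈ I
    ∈-support {I} I∈Σ {i} x<νIi with i SubsetP.∈? I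
    ... | yes i∈I = i∈I
    ... | no  i∉I = ⊥-elim (ℕP.n≮0 (≡.subst (_ <_) (MM1 I∈Σ i i∉I) x<νIi))

    ∉-support : ∀ {I} → I ∈ Sig → ∀ {i} → i Subset.∉ I → ∀ {x v} → x < v → lookup (ν I) i < v
    ∉-support I∈Σ {i} i∉I x<v = ≡.subst (_< _) (≡.sym (MM1 I∈Σ i i∉I)) (ℕP.≤-<-trans z≤n x<v)

    ⊆-later : ∀ {k} J (U : Chain k) → Increasing (J ∷ U) → VAll.All (J ⊆_) U
    ⊆-later J []      _            = VAll.[]
    ⊆-later J (K ∷ U) (J⊂K , K∷U↑) =
      proj₁ J⊂K VAll.∷ VAll.map (λ K⊆W {x} x∈J → K⊆W (proj₁ J⊂K x∈J)) (⊆-later K U K∷U↑)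

    ν-antitone : ∀ {k J} (U : Chain k) → J ∈ Sig → VAll.All (_∈ Sig) U → VAll.All (J ⊆_) U →
                 ∀ {i} → i Subset.∈ J → VAll.All (λ W → lookup (ν W) i ≤ lookup (ν J) i) U
    ν-antitone U J∈Σ U⊆Σ J⊆U i∈J = VAll.map (λ (W∈Σ , J⊆W) → MM2 J∈Σ W∈Σ J⊆W i∈J) (VAll.zip (U⊆Σ , J⊆U))

    a-< : ∀ {k} (X : Chain (suc k)) i {v} → VAll.All (λ W → lookup (ν W) i < v) X → lookup (a X) i < v
    a-< (W ∷ [])     i (νWi<v VAll.∷ _) =
      ≡.subst (_< _) (≡.sym (≡.trans (lookup-lcmᵐ (ν W) oneᵐ i)
                                    (≡.trans (≡.cong (lookup (ν W) i ℕ.⊔_) (lookup-oneᵐ i)) (ℕP.⊔-identityʳ _)))) νWi<v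
    a-< (W ∷ V ∷ X) i (νWi<v VAll.∷ V∷X<v) =
      ≡.subst (_< _) (≡.sym (lookup-lcmᵐ (ν W) (a (V ∷ X)) i)) (ℕP.⊔-lub νWi<v (a-< (V ∷ X) i V∷X<v))

    first-dominates : ∀ {k} I J (U : Chain k) → ValidChain (I ∷ J ∷ U) →
                      ∃ λ i → VAll.All (λ W → lookup (ν W) i < lookup (ν I) i) (J ∷ U)
    first-dominates I J U ((I∈Σ VAll.∷ J∈Σ VAll.∷ U⊆Σ) , I⊂J , J∷U↑)
      with ∤ᵐ-witness (ν I) (ν J) (SM1 I∈Σ J∈Σ (λ I≡J → SubsetP.⊂-irref I≡J I⊂J))
    ... | i , νJi<νIi = i , νJi<νIi VAll.∷
      VAll.map (λ νWi≤νJi → ℕP.≤-<-trans νWi≤νJi νJi<νIi)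
               (ν-antitone U J∈Σ U⊆Σ (⊆-later J U J∷U↑) (proj₁ I⊂J (∈-support I∈Σ νJi<νIi)))

    -- i ∉ I is carried along so that, by (MM1), ν vanishes at i on I and on all members before it.
    later-dominates : ∀ {k} I (U : Chain (suc k)) j → ValidChain (I ∷ U) →
      ∃ λ i → i Subset.∉ I × VAll.All (λ W → lookup (ν W) i < lookup (ν (lookup U j)) i) (Vec.removeAt (I ∷ U) (Fin.suc j))
    later-dominates I (J ∷ []) Fin.zero ((I∈Σ VAll.∷ J∈Σ VAll.∷ _) , I⊂J , _)
      with ∤ᵐ-witness (ν J) (ν I) (SM1 J∈Σ I∈Σ (λ J≡I → SubsetP.⊂-irref (≡.sym J≡I) I⊂J))
    ... | i , νIi<νJi = i , (λ i∈I → ℕP.<-irrefl ≡.refl (ℕP.<-≤-trans νIi<νJi (MM2 I∈Σ J∈Σ (proj₁ I⊂J) i∈I))) ,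
                        νIi<νJi VAll.∷ VAll.[]
    later-dominates I (J ∷ K ∷ U) Fin.zero ((I∈Σ VAll.∷ J∈Σ VAll.∷ K∈Σ VAll.∷ U⊆Σ) , I⊂J , J⊂K , K∷U↑)
      with SM2 I∈Σ J∈Σ K∈Σ I⊂J J⊂K
    ... | i , i∈J , i∉I , νKi<νJi = i , i∉I ,
      ∉-support I∈Σ i∉I νKi<νJi VAll.∷ νKi<νJi VAll.∷
      VAll.map (λ νWi≤νKi → ℕP.≤-<-trans νWi≤νKi νKi<νJi)
               (ν-antitone U K∈Σ U⊆Σ (⊆-later K U K∷U↑) (proj₁ J⊂K i∈J))
    later-dominates I (J ∷ K ∷ U) (Fin.suc j) ((I∈Σ VAll.∷ J∷K∷U⊆Σ) , I⊂J , J∷K∷U↑)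
      with later-dominates J (K ∷ U) j (J∷K∷U⊆Σ , J∷K∷U↑)
    ... | i , i∉J , rest<νi = i , i∉I , ∉-support I∈Σ i∉I (VAll.head rest<νi) VAll.∷ rest<νi
      where i∉I = λ i∈I → i∉J (proj₁ I⊂J i∈I)

    removeAt-dominated : ∀ {k} (U : Chain (suc (suc k))) → ValidChain U → ∀ j →
      ∃ λ i → VAll.All (λ W → lookup (ν W) i < lookup (ν (lookup U j)) i) (Vec.removeAt U j)
    removeAt-dominated (I ∷ J ∷ U) U-valid Fin.zero    = first-dominates I J U U-valid
    removeAt-dominated (I ∷ U)     U-valid (Fin.suc j) = Product.map₂ proj₂ (later-dominates I U j U-valid)

    a-removeAt-< : ∀ {k} (U : Chain (suc (suc k))) → ValidChain U → ∀ j →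
                   ∃ λ i → lookup (a (Vec.removeAt U j)) i < lookup (a U) i
    a-removeAt-< U U-valid j =
      let i , dominated = removeAt-dominated U U-valid j
      in  i , ℕP.<-≤-trans (a-< (Vec.removeAt U j) i dominated) (VAllP.lookup⁺ (∣ᵐ-a U) j i)

    face-degree-≢oneᵐ : ∀ {k} (U : Chain (suc (suc k))) → ValidChain U → ∀ d j →
                         (d *ᵐ (a U ∸ᵐ a (Vec.removeAt U j))) ≢ oneᵐ
    face-degree-≢oneᵐ U U-valid d j d*[aU∸aV]≡1 =
      let i , aVi<aUi = a-removeAt-< U U-valid j
          V = Vec.removeAt U j
      in  ℕP.<⇒≱ aVi<aUi (ℕP.m∸n≡0⇒m≤n (begin
            lookup (a U) i ℕ.∸ lookup (a V) i  ≡⟨ lookup-∸ᵐ (a U) (a V) i ⟨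
            lookup (a U ∸ᵐ a V) i              ≡⟨ ℕP.m+n≡0⇒n≡0 (lookup d i) (begin
              lookup d i ℕ.+ lookup (a U ∸ᵐ a V) i  ≡⟨ lookup-*ᵐ d (a U ∸ᵐ a V) i ⟨
              lookup (d *ᵐ (a U ∸ᵐ a V)) i          ≡⟨ ≡.cong (λ e → lookup e i) d*[aU∸aV]≡1 ⟩
              lookup (oneᵐ {n}) i                   ≡⟨ lookup-oneᵐ i ⟩
              0                                     ∎) ⟩
            0                                  ∎))
      where open ≡.≡-Reasoning

    minimal : IsMinimal
    minimal k z z-valid U =
      ≡.subst (_≈ 0#) (≡.sym (coeff-≡ (∂ z) U oneᵐ)) (E.coeff-∉ (∂ z) (no-constant-term z z-valid))
      where
      no-constant-term : ∀ (z : Elem (suc (suc k))) → Valid z → All (λ (_ , V , e) → (V , e) ≢ (U , oneᵐ)) (∂ z)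
      no-constant-term []                []                 = []
      no-constant-term ((r , V , d) ∷ z) (V-valid ∷ z-valid) = AllP.++⁺
        (AllP.map⁺ (AllP.tabulate⁺ {f = id} λ j → face-degree-≢oneᵐ V V-valid d j ∘ ≡.cong proj₂))
        (no-constant-term z z-valid)

corollary6p4 : ∀ {c ℓ : Level} (𝕂 : Field c ℓ) (n : ℕ)
                 (Sig : List (Subset n)) (ν : Subset n → Mono n) →
                 MonotoneFamily Sig ν →
                 OrderComplex.IsFreeResolution 𝕂 Sig ν
                 × (StrictlyMonotone Sig ν → OrderComplex.IsMinimal 𝕂 Sig ν)
corollary6p4 𝕂 n Sig ν mf = isFreeResolution , minimal mf
  where
  open Resolution 𝕂 Sig ν
  isFreeResolution : OrderComplex.IsFreeResolution 𝕂 Sig ν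
  isFreeResolution = record
    { complex = λ k z _ → ≈ₛ⇒≈E (∂∘∂ z)
    ; image₁  = image-∂₁
    ; exact   = exact mf
    }
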